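{- In $\mathfrak{h}[[X,Y]]$ the identity \[ \Phi_{ -yY}^{ -1}\!\left(\frac{ -y}{1+yX}\right)=\left(\frac{1}{1-zY}\ \text{ш}\ \frac{1}{1+yX}\right)(-y) \] holds.
   Context: Let $\mathfrak{h}=\mathbb{Q}\langle x,y\rangle$ be the noncommutative polynomial algebra over $\mathbb{Q}$ in $x,y$, and $z=x+y$. $X,Y$ are commuting formal variables commuting with $x,y$; $\mathfrak{h}[[X,Y]]$ is the ring of formal power series in $X,Y$ with coefficients in $\mathfrak{h}$, and $\frac{1}{1-u}=\sum_{m\ge0}u^m$. The shuffle product $\text{ш}$ on $\mathfrak{h}$ is the $\mathbb{Q}$-bilinear map with $1\ \text{ш}\ w=w\ \text{ш}\ 1=w$ and $uw\ \text{ш}\ vw'=u(w\ \text{ш}\ vw')+v(uw\ \text{ш}\ w')$ for letters $u,v\in\{x,y\}$ and words $w,w'$; it is extended to power series bilinearly in the coefficients (with $X,Y$ treated as scalars). $\Phi_{ -yY}$ is the continuous $\mathbb{Q}[[X,Y]]$-algebra automorphism of $\mathfrak{h}[[X,Y]]$ determined by $\Phi_{ -yY}(x)=x$ and $\Phi_{ -yY}(z)=z\frac{1}{1+yY}$, and $\Phi_{ -yY}^{ -1}$ is its inverse. (On $\mathfrak{h}^1=\mathbb{Q}+\mathfrak{h}y$ it satisfies $\Phi_{ -yY}(w)=(1+yY)\bigl(\frac{1}{1+yY}\ast w\bigr)$, where $\ast$ is the harmonic product defined by $1\ast w=w\ast1=w$ and $z_kw\ast z_lw'=z_k(w\ast z_lw')+z_l(z_kw\ast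 w')+z_{k+l}(w\ast w')$ with $z_k=x^{k-1}y$.) -}

module Defs where

open import Data.Nat using (ℕ; zero; suc; _+_; _∸_)
open import Data.List using (List; []; _∷_; map; concatMap; _++_; foldr; upTo)
open import Data.List.Properties using (≡-dec)
open import Data.Product using (_×_; _,_; proj₁; proj₂)
open import Data.Rational as Q using (ℚ; 0ℚ; 1ℚ)
open import Relation.Nullary using (yes; no)
open import Relation.Binary.PropositionalEquality using (_≡_; refl)
open import Relation.Binary.Definitions using (DecidableEquality)

-- The free noncommutative algebra 𝔥 = ℚ⟨x,y⟩

data Letter : Set where
  x y : Letter

_≟L_ : DecidableEquality Letter
x ≟L x = yes refl
x ≟L y = no λ ()
y ≟L x = no λ ()
y ≟L y = yes refl

Word : Set
Word = List Letter

_≟W_ : DecidableEquality Word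
_≟W_ = ≡-dec _≟L_

-- an element of 𝔥, as a finite formal ℚ-linear combination of words
Poly : Set
Poly = List (ℚ × Word)

coeff : Poly → Word → ℚ
coeff [] w = 0ℚ
coeff ((c , u) ∷ p) w with u ≟W w
... | yes _ = c Q.+ coeff p w
... | no  _ = coeff p w

_≈ₚ_ : Poly → Poly → Set
p ≈ₚ q = ∀ w → coeff p w ≡ coeff q w

0ₚ : Poly
0ₚ = []

1ₚ : Poly
1ₚ = (1ℚ , []) ∷ []

letter : Letter → Poly
letter l = (1ℚ , l ∷ []) ∷ []

_+ₚ_ : Poly → Poly → Poly
p +ₚ q = p ++ q

scale : ℚ → Poly → Poly
scale c p = map (λ t → (c Q.* proj₁ t) , proj₂ t) p

-ₚ_ : Poly → Poly
-ₚ p = scale (Q.- 1ℚ) p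

_·ₚ_ : Poly → Poly → Poly
p ·ₚ q = concatMap (λ s → map (λ t → (proj₁ s Q.* proj₁ t) , (proj₂ s ++ proj₂ t)) q) p

_ш_ : Word → Word → List Word
[] ш v = v ∷ []
(a ∷ u) ш [] = (a ∷ u) ∷ []
(a ∷ u) ш (b ∷ v) = map (a ∷_) (u ш (b ∷ v)) ++ map (b ∷_) ((a ∷ u) ш v)

_шₚ_ : Poly → Poly → Poly
p шₚ q = concatMap (λ s → concatMap (λ t →
           map (λ w → (proj₁ s Q.* proj₁ t) , w) (proj₂ s ш proj₂ t)) q) p

z : Poly
z = letter x +ₚ letter y

sumP : List Poly → Poly
sumP = foldr _+ₚ_ 0ₚ

-- 𝔥[[X,Y]]: a series S is given by its coefficients S a b ∈ 𝔥 of X^a Y^b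

Ser : Set
Ser = ℕ → ℕ → Poly

_≈_ : Ser → Ser → Set
S ≈ T = ∀ a b → S a b ≈ₚ T a b

-- p X^i Y^j
mono : ℕ → ℕ → Poly → Ser
mono zero zero p zero zero = p
mono zero zero p zero (suc b) = 0ₚ
mono zero zero p (suc a) b = 0ₚ
mono zero (suc j) p a zero = 0ₚ
mono zero (suc j) p a (suc b) = mono zero j p a b
mono (suc i) j p zero b = 0ₚ
mono (suc i) j p (suc a) b = mono i j p a b

const : Poly → Ser
const p = mono 0 0 p

_⊕_ : Ser → Ser → Ser
(S ⊕ T) a b = S a b +ₚ T a b

_⊖_ : Ser → Ser → Ser
(S ⊖ T) a b = S a b +ₚ (-ₚ T a b)

conv : (Poly → Poly → Poly) → Ser → Ser → Ser
conv op S T a b =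
  sumP (concatMap (λ i → map (λ j → op (S i j) (T (a ∸ i) (b ∸ j)))
                             (upTo (suc b)))
                  (upTo (suc a)))

_·_ : Ser → Ser → Ser
_·_ = conv _·ₚ_

-- shuffle product extended to 𝔥[[X,Y]] (X,Y treated as scalars)
_шₛ_ : Ser → Ser → Ser
_шₛ_ = conv _шₚ_

pow : Ser → ℕ → Ser
pow S zero = const 1ₚ
pow S (suc m) = S · pow S m

-- 1/(1-u) = Σ_{m ≥ 0} u^m, for u without constant term
-- (then only m ≤ a + b contributes to the coefficient of X^a Y^b)
geom : Ser → Ser
geom u a b = sumP (map (λ m → pow u m a b) (upTo (suc (a + b))))

-- The automorphism Φ_{-yY}: Φ(x) = x, Φ(z) = z/(1+yY), hence
-- Φ(y) = Φ(z) - Φ(x) = z · 1/(1 - (-yY)) - x; continuous ℚ[[X,Y]]-algebra map.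

-yY : Ser
-yY = mono 0 1 (-ₚ letter y)

Φletter : Letter → Ser
Φletter x = const (letter x)
Φletter y = (const z · geom -yY) ⊖ const (letter x)

Φword : Word → Ser
Φword [] = const 1ₚ
Φword (l ∷ w) = Φletter l · Φword w

Φpoly : Poly → Ser
Φpoly p a b = sumP (map (λ t → scale (proj₁ t) (Φword (proj₂ t) a b)) p)

Φ : Ser → Ser
Φ S a b =
  sumP (concatMap (λ i → map (λ j → Φpoly (S i j) (a ∸ i) (b ∸ j))
                             (upTo (suc b)))
                  (upTo (suc a)))

-- -y/(1+yX) = (-y) · 1/(1 - (-yX))
lhsArg : Ser
lhsArg = const (-ₚ letter y) · geom (mono 1 0 (-ₚ letter y))

rhs : Ser
rhs = (geom (mono 0 1 z) шₛ geom (mono 1 0 (-ₚ letter y))) · const (-ₚ letter y)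

IsInverseOfΦ : (Ser → Ser) → Set
IsInverseOfΦ Ψ =
  (∀ S T → S ≈ T → Ψ S ≈ Ψ T) × (∀ S → Ψ (Φ S) ≈ S) × (∀ S → Φ (Ψ S) ≈ S)

{-# OPTIONS --safe #-}
-- Since Φ fixes X, it suffices to show Φ(R_a) = (-y)^a for the series in Y given by
-- R_0 = 1 and R_(a+1) = (1/(1-zY) ш (-y)^a)(-y), the coefficient of X^a on the right.
-- The shuffle recursion (ℓp) ш (mq) = ℓ(p ш mq) + m(ℓp ш q), which is linear in the
-- letters ℓ and m and so holds for ℓ = z and m = -y, gives R_(a+1) = -y R_a + zY R_(a+1).
-- Applying the algebra map Φ, with Φ(z) = z/(1+yY) and Φ(-y) = x - Φ(z), the powers
-- (-y)^a satisfy the same recursion: the extra terms zyY/(1+yY)(-y)^a and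
-- zY/(1+yY)(-y)^(a+1) cancel. The factor Y makes the solution unique, so induction on a
-- and then strong induction on the Y-degree finishes.

module Submission where

open import Defs
open import Data.Empty using (⊥-elim)
open import Data.List using (List; []; _∷_; map; concatMap; _++_; upTo; applyUpTo; length)
import Data.List.Properties as List
open import Data.Nat as ℕ using (ℕ; zero; suc; _∸_; z≤n; s≤s)
open import Data.Nat.Induction using (<-rec)
import Data.Nat.Properties as ℕ
open import Data.Product using (_×_; _,_; proj₁; proj₂)
open import Data.Rational as ℚ using (ℚ; 0ℚ; 1ℚ)
import Data.Rational.Properties as ℚ
open import Data.Rational.Solver using (module +-*-Solver)
open import Data.Sum using (inj₁; inj₂)
open import Function using (_∘_)
open import Level using (0ℓ)
open import Relation.Binary.Bundles using (Setoid)
import Relation.Binary.Reasoning.Setoid as SetoidReasoning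
open import Relation.Binary.PropositionalEquality
open import Relation.Nullary using (yes; no; ¬_)

open +-*-Solver using (solve; _:=_; _:+_; _:*_; con)

-- A record rather than ≈ₚ itself, so that p and q can be inferred from a proof of p ≋ q.
infix 4 _≋_
record _≋_ (p q : Poly) : Set where
  constructor coeffwise
  field same-coeff : p ≈ₚ q
open _≋_ public

≋-setoid : Setoid 0ℓ 0ℓ
≋-setoid = record
  { Carrier = Poly
  ; _≈_ = _≋_
  ; isEquivalence = record
    { refl = coeffwise λ _ → refl
    ; sym = λ e → coeffwise λ w → sym (same-coeff e w)
    ; trans = λ e f → coeffwise λ w → trans (same-coeff e w) (same-coeff f w)
    }
  }

open Setoid ≋-setoid public using () renaming (refl to ≋-refl; sym to ≋-sym; trans to ≋-trans; reflexive to ≡⇒≋)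
module ≋-Reasoning = SetoidReasoning ≋-setoid

coeff-+ₚ : ∀ p q w → coeff (p +ₚ q) w ≡ coeff p w ℚ.+ coeff q w
coeff-+ₚ [] q w = sym (ℚ.+-identityˡ _)
coeff-+ₚ ((c , u) ∷ p) q w with u ≟W w
... | yes _ = trans (cong (c ℚ.+_) (coeff-+ₚ p q w)) (sym (ℚ.+-assoc c _ _))
... | no _ = coeff-+ₚ p q w

coeff-scale : ∀ c p w → coeff (scale c p) w ≡ c ℚ.* coeff p w
coeff-scale c [] w = sym (ℚ.*-zeroʳ c)
coeff-scale c ((d , u) ∷ p) w with u ≟W w
... | yes _ = trans (cong (c ℚ.* d ℚ.+_) (coeff-scale c p w)) (sym (ℚ.*-distribˡ-+ c d _))
... | no _ = coeff-scale c p w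

+ₚ-cong : ∀ {p p′ q q′} → p ≋ p′ → q ≋ q′ → (p +ₚ q) ≋ (p′ +ₚ q′)
+ₚ-cong {p} {p′} {q} {q′} e f = coeffwise λ w → begin
  coeff (p +ₚ q) w              ≡⟨ coeff-+ₚ p q w ⟩
  coeff p w ℚ.+ coeff q w       ≡⟨ cong₂ ℚ._+_ (same-coeff e w) (same-coeff f w) ⟩
  coeff p′ w ℚ.+ coeff q′ w     ≡⟨ coeff-+ₚ p′ q′ w ⟨
  coeff (p′ +ₚ q′) w            ∎
  where open ≡-Reasoning

+ₚ-congˡ : ∀ p {q q′} → q ≋ q′ → (p +ₚ q) ≋ (p +ₚ q′)
+ₚ-congˡ p = +ₚ-cong (≋-refl {p})

+ₚ-congʳ : ∀ q {p p′} → p ≋ p′ → (p +ₚ q) ≋ (p′ +ₚ q)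
+ₚ-congʳ q e = +ₚ-cong e (≋-refl {q})

+ₚ-identityʳ : ∀ p → (p +ₚ 0ₚ) ≋ p
+ₚ-identityʳ p = ≡⇒≋ (List.++-identityʳ p)

+ₚ-interchange : ∀ p q r s → ((p +ₚ q) +ₚ (r +ₚ s)) ≋ ((p +ₚ r) +ₚ (q +ₚ s))
+ₚ-interchange p q r s = coeffwise λ w → begin
  coeff ((p +ₚ q) +ₚ (r +ₚ s)) w
    ≡⟨ expand p q r s w ⟩
  (coeff p w ℚ.+ coeff q w) ℚ.+ (coeff r w ℚ.+ coeff s w)
    ≡⟨ solve 4 (λ a b c d → (a :+ b) :+ (c :+ d) := (a :+ c) :+ (b :+ d)) refl
               (coeff p w) (coeff q w) (coeff r w) (coeff s w) ⟩
  (coeff p w ℚ.+ coeff r w) ℚ.+ (coeff q w ℚ.+ coeff s w)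
    ≡⟨ expand p r q s w ⟨
  coeff ((p +ₚ r) +ₚ (q +ₚ s)) w
    ∎
  where
  open ≡-Reasoning
  expand : ∀ p q r s w → coeff ((p +ₚ q) +ₚ (r +ₚ s)) w
         ≡ (coeff p w ℚ.+ coeff q w) ℚ.+ (coeff r w ℚ.+ coeff s w)
  expand p q r s w = trans (coeff-+ₚ (p +ₚ q) (r +ₚ s) w) (cong₂ ℚ._+_ (coeff-+ₚ p q w) (coeff-+ₚ r s w))

+ₚ-comm : ∀ p q → (p +ₚ q) ≋ (q +ₚ p)
+ₚ-comm p q = coeffwise λ w →
  trans (coeff-+ₚ p q w) (trans (ℚ.+-comm (coeff p w) (coeff q w)) (sym (coeff-+ₚ q p w)))

-ₚ-inverseˡ : ∀ p → ((-ₚ p) +ₚ p) ≋ 0ₚ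
-ₚ-inverseˡ p = coeffwise λ w →
  trans (coeff-+ₚ (-ₚ p) p w) (trans (cong (ℚ._+ coeff p w) (coeff-scale (ℚ.- 1ℚ) p w))
    (solve 1 (λ a → con (ℚ.- 1ℚ) :* a :+ a := con 0ℚ) refl (coeff p w)))

scale-cong : ∀ c {p q} → p ≋ q → scale c p ≋ scale c q
scale-cong c {p} {q} e = coeffwise λ w →
  trans (coeff-scale c p w) (trans (cong (c ℚ.*_) (same-coeff e w)) (sym (coeff-scale c q w)))

scale-+ₚ : ∀ c p q → scale c (p +ₚ q) ≡ (scale c p +ₚ scale c q)
scale-+ₚ c = List.map-++ _

extend : (Word → ℚ) → Poly → ℚ
extend g [] = 0ℚ
extend g ((c , u) ∷ p) = c ℚ.* g u ℚ.+ extend g p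

extend-+ₚ : ∀ g p q → extend g (p +ₚ q) ≡ extend g p ℚ.+ extend g q
extend-+ₚ g [] q = sym (ℚ.+-identityˡ _)
extend-+ₚ g ((c , u) ∷ p) q =
  trans (cong (c ℚ.* g u ℚ.+_) (extend-+ₚ g p q)) (sym (ℚ.+-assoc (c ℚ.* g u) (extend g p) (extend g q)))

extend-scale : ∀ g c p → extend g (scale c p) ≡ c ℚ.* extend g p
extend-scale g c [] = sym (ℚ.*-zeroʳ c)
extend-scale g c ((d , u) ∷ p) rewrite extend-scale g c p =
  solve 4 (λ c d a e → (c :* d) :* a :+ c :* e := c :* (d :* a :+ e)) refl c d (g u) (extend g p)

extend-congˡ : ∀ {g h} → (∀ u → g u ≡ h u) → ∀ p → extend g p ≡ extend h p
extend-congˡ e [] = refl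
extend-congˡ e ((c , u) ∷ p) = cong₂ (λ a b → c ℚ.* a ℚ.+ b) (e u) (extend-congˡ e p)

extend-+ : ∀ g h p → extend (λ u → g u ℚ.+ h u) p ≡ extend g p ℚ.+ extend h p
extend-+ g h [] = sym (ℚ.+-identityˡ _)
extend-+ g h ((c , u) ∷ p) rewrite extend-+ g h p =
  solve 5 (λ c a b e f → c :* (a :+ b) :+ (e :+ f) := (c :* a :+ e) :+ (c :* b :+ f)) refl
        c (g u) (h u) (extend g p) (extend h p)

extend-* : ∀ d g p → extend (λ u → d ℚ.* g u) p ≡ d ℚ.* extend g p
extend-* d g [] = sym (ℚ.*-zeroʳ d)
extend-* d g ((c , u) ∷ p) rewrite extend-* d g p =
  solve 4 (λ d c a e → c :* (d :* a) :+ d :* e := d :* (c :* a :+ e)) refl d c (g u) (extend g p)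

extend-0 : ∀ p → extend (λ _ → 0ℚ) p ≡ 0ℚ
extend-0 [] = refl
extend-0 ((c , u) ∷ p) rewrite extend-0 p = solve 1 (λ c → c :* con 0ℚ :+ con 0ℚ := con 0ℚ) refl c

δ : Word → Word → ℚ
δ v u with u ≟W v
... | yes _ = 1ℚ
... | no _ = 0ℚ

coeff-as-extend : ∀ p v → coeff p v ≡ extend (δ v) p
coeff-as-extend [] v = refl
coeff-as-extend ((c , u) ∷ p) v with u ≟W v
... | yes _ rewrite coeff-as-extend p v = cong (ℚ._+ extend (δ v) p) (sym (ℚ.*-identityʳ c))
... | no _ rewrite coeff-as-extend p v = sym (trans (cong (ℚ._+ extend (δ v) p) (ℚ.*-zeroʳ c)) (ℚ.+-identityˡ _))

-- To see that extend g respects ≋, drop the terms of one word at a time.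

remove : Word → Poly → Poly
remove w [] = []
remove w ((c , u) ∷ p) with u ≟W w
... | yes _ = remove w p
... | no _ = (c , u) ∷ remove w p

extend-remove : ∀ g w p → extend g p ≡ coeff p w ℚ.* g w ℚ.+ extend g (remove w p)
extend-remove g w [] = solve 1 (λ a → con 0ℚ := con 0ℚ :* a :+ con 0ℚ) refl (g w)
extend-remove g w ((c , u) ∷ p) with u ≟W w
... | yes refl rewrite extend-remove g u p =
  solve 4 (λ c a b e → c :* a :+ (b :* a :+ e) := (c :+ b) :* a :+ e) refl c (g u) (coeff p u) (extend g (remove u p))
... | no _ rewrite extend-remove g w p =
  solve 5 (λ c a b e f → c :* a :+ (b :* e :+ f) := b :* e :+ (c :* a :+ f)) refl
        c (g u) (coeff p w) (g w) (extend g (remove w p))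

coeff-remove : ∀ w v p → ¬ v ≡ w → coeff (remove w p) v ≡ coeff p v
coeff-remove w v [] v≢w = refl
coeff-remove w v ((c , u) ∷ p) v≢w with u ≟W w
... | yes refl with u ≟W v
...   | yes refl = ⊥-elim (v≢w refl)
...   | no _ = coeff-remove w v p v≢w
coeff-remove w v ((c , u) ∷ p) v≢w | no _ with u ≟W v
...   | yes _ = cong (c ℚ.+_) (coeff-remove w v p v≢w)
...   | no _ = coeff-remove w v p v≢w

coeff-remove-self : ∀ w p → coeff (remove w p) w ≡ 0ℚ
coeff-remove-self w [] = refl
coeff-remove-self w ((c , u) ∷ p) with u ≟W w
... | yes _ = coeff-remove-self w p
... | no u≢w with u ≟W w
...   | yes u≡w = ⊥-elim (u≢w u≡w)
...   | no _ = coeff-remove-self w p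

remove-head : ∀ c u p → remove u ((c , u) ∷ p) ≡ remove u p
remove-head c u p with u ≟W u
... | yes _ = refl
... | no u≢u = ⊥-elim (u≢u refl)

length-remove : ∀ w p → length (remove w p) ℕ.≤ length p
length-remove w [] = z≤n
length-remove w ((c , u) ∷ p) with u ≟W w
... | yes _ = ℕ.m≤n⇒m≤1+n (length-remove w p)
... | no _ = s≤s (length-remove w p)

extend-null : ∀ n g p → length p ℕ.≤ n → (∀ w → coeff p w ≡ 0ℚ) → extend g p ≡ 0ℚ
extend-null n g [] _ _ = refl
extend-null (suc n) g ((c , u) ∷ p) (s≤s ∣p∣≤n) null = begin
  extend g ((c , u) ∷ p)                                    ≡⟨ extend-remove g u ((c , u) ∷ p) ⟩
  coeff ((c , u) ∷ p) u ℚ.* g u ℚ.+ extend g (remove u p′)   ≡⟨ cong₂ (λ a b → a ℚ.* g u ℚ.+ b) (null u) rest ⟩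
  0ℚ ℚ.* g u ℚ.+ 0ℚ                                         ≡⟨ solve 1 (λ a → con 0ℚ :* a :+ con 0ℚ := con 0ℚ) refl (g u) ⟩
  0ℚ                                                        ∎
  where
  open ≡-Reasoning
  p′ = (c , u) ∷ p
  rest : extend g (remove u p′) ≡ 0ℚ
  rest rewrite remove-head c u p =
    extend-null n g (remove u p) (ℕ.≤-trans (length-remove u p) ∣p∣≤n) null′
    where
    null′ : ∀ v → coeff (remove u p) v ≡ 0ℚ
    null′ v with v ≟W u
    ... | yes refl = coeff-remove-self u p
    ... | no v≢u = trans (cong (λ r → coeff r v) (sym (remove-head c u p))) (trans (coeff-remove u v p′ v≢u) (null v))

extend-resp : ∀ g {p q} → p ≋ q → extend g p ≡ extend g q
extend-resp g {p} {q} e = begin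
  extend g p                                   ≡⟨ solve 2 (λ a b → a := (a :+ con (ℚ.- 1ℚ) :* b) :+ b) refl (extend g p) (extend g q) ⟩
  (extend g p ℚ.+ ℚ.- 1ℚ ℚ.* extend g q) ℚ.+ extend g q
    ≡⟨ cong (ℚ._+ extend g q) (trans (extend-+ₚ g p (-ₚ q)) (cong (extend g p ℚ.+_) (extend-scale g (ℚ.- 1ℚ) q))) ⟨
  extend g (p +ₚ (-ₚ q)) ℚ.+ extend g q        ≡⟨ cong (ℚ._+ extend g q) (extend-null _ g (p +ₚ (-ₚ q)) ℕ.≤-refl null) ⟩
  0ℚ ℚ.+ extend g q                            ≡⟨ ℚ.+-identityˡ _ ⟩
  extend g q                                   ∎
  where
  open ≡-Reasoning
  null : ∀ w → coeff (p +ₚ (-ₚ q)) w ≡ 0ℚ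
  null w = trans (coeff-+ₚ p (-ₚ q) w) (trans (cong₂ ℚ._+_ (same-coeff e w) (coeff-scale (ℚ.- 1ℚ) q w))
             (solve 1 (λ a → a :+ con (ℚ.- 1ℚ) :* a := con 0ℚ) refl (coeff q w)))

≋-by-extend : ∀ {p q} → (∀ v → extend (δ v) p ≡ extend (δ v) q) → p ≋ q
≋-by-extend {p} {q} e = coeffwise λ v → trans (coeff-as-extend p v) (trans (e v) (sym (coeff-as-extend q v)))

bilinear : (Word → Word → List Word) → Poly → Poly → Poly
bilinear f p q = concatMap (λ s → concatMap (λ t →
  map (λ w → (proj₁ s ℚ.* proj₁ t) , w) (f (proj₂ s) (proj₂ t))) q) p

extendWords : (Word → ℚ) → List Word → ℚ
extendWords g [] = 0ℚ
extendWords g (w ∷ L) = g w ℚ.+ extendWords g L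

extendWords-++ : ∀ g L M → extendWords g (L ++ M) ≡ extendWords g L ℚ.+ extendWords g M
extendWords-++ g [] M = sym (ℚ.+-identityˡ _)
extendWords-++ g (w ∷ L) M = trans (cong (g w ℚ.+_) (extendWords-++ g L M)) (sym (ℚ.+-assoc (g w) _ _))

extendWords-map : ∀ g (h : Word → Word) L → extendWords g (map h L) ≡ extendWords (g ∘ h) L
extendWords-map g h [] = refl
extendWords-map g h (w ∷ L) = cong (g (h w) ℚ.+_) (extendWords-map g h L)

extend-weighted : ∀ g d L → extend g (map (λ w → (d , w)) L) ≡ d ℚ.* extendWords g L
extend-weighted g d [] = sym (ℚ.*-zeroʳ d)
extend-weighted g d (w ∷ L) rewrite extend-weighted g d L = sym (ℚ.*-distribˡ-+ d (g w) _)

extend-bilinear : ∀ g f p q →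
  extend g (bilinear f p q) ≡ extend (λ u → extend (λ u′ → extendWords g (f u u′)) q) p
extend-bilinear g f [] q = refl
extend-bilinear g f ((c , u) ∷ p) q =
  trans (extend-+ₚ g (row q) _) (cong₂ ℚ._+_ (extend-row q) (extend-bilinear g f p q))
  where
  row : Poly → Poly
  row q = concatMap (λ t → map (λ w → (c ℚ.* proj₁ t) , w) (f u (proj₂ t))) q
  extend-row : ∀ q → extend g (row q) ≡ c ℚ.* extend (λ u′ → extendWords g (f u u′)) q
  extend-row [] = sym (ℚ.*-zeroʳ c)
  extend-row ((d , u′) ∷ q) =
    trans (extend-+ₚ g (map (λ w → (c ℚ.* d) , w) (f u u′)) (row q))
      (trans (cong₂ ℚ._+_ (extend-weighted g (c ℚ.* d) (f u u′)) (extend-row q))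
        (solve 4 (λ c d a e → c :* d :* a :+ c :* e := c :* (d :* a :+ e)) refl
               c d (extendWords g (f u u′)) (extend (λ u′ → extendWords g (f u u′)) q)))

module _ (f : Word → Word → List Word) where

  bilinear-cong : ∀ {p p′ q q′} → p ≋ p′ → q ≋ q′ → bilinear f p q ≋ bilinear f p′ q′
  bilinear-cong {p} {p′} {q} {q′} e e′ = ≋-by-extend λ v → begin
    extend (δ v) (bilinear f p q)                                      ≡⟨ extend-bilinear (δ v) f p q ⟩
    extend (λ u → extend (λ u′ → extendWords (δ v) (f u u′)) q) p      ≡⟨ extend-resp _ e ⟩
    extend (λ u → extend (λ u′ → extendWords (δ v) (f u u′)) q) p′     ≡⟨ extend-congˡ (λ u → extend-resp _ e′) p′ ⟩
    extend (λ u → extend (λ u′ → extendWords (δ v) (f u u′)) q′) p′    ≡⟨ extend-bilinear (δ v) f p′ q′ ⟨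
    extend (δ v) (bilinear f p′ q′)                                    ∎
    where open ≡-Reasoning

  bilinear-distribʳ : ∀ p p′ q → bilinear f (p +ₚ p′) q ≡ (bilinear f p q +ₚ bilinear f p′ q)
  bilinear-distribʳ p p′ q = List.concatMap-++ _ p p′

  bilinear-distribˡ : ∀ p q q′ → bilinear f p (q +ₚ q′) ≋ (bilinear f p q +ₚ bilinear f p q′)
  bilinear-distribˡ p q q′ = ≋-by-extend λ v → begin
    extend (δ v) (bilinear f p (q +ₚ q′))
      ≡⟨ extend-bilinear (δ v) f p (q +ₚ q′) ⟩
    extend (λ u → extend (F v u) (q +ₚ q′)) p
      ≡⟨ extend-congˡ (λ u → extend-+ₚ (F v u) q q′) p ⟩
    extend (λ u → extend (F v u) q ℚ.+ extend (F v u) q′) p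
      ≡⟨ extend-+ _ _ p ⟩
    extend (λ u → extend (F v u) q) p ℚ.+ extend (λ u → extend (F v u) q′) p
      ≡⟨ cong₂ ℚ._+_ (extend-bilinear (δ v) f p q) (extend-bilinear (δ v) f p q′) ⟨
    extend (δ v) (bilinear f p q) ℚ.+ extend (δ v) (bilinear f p q′)
      ≡⟨ extend-+ₚ (δ v) (bilinear f p q) (bilinear f p q′) ⟨
    extend (δ v) (bilinear f p q +ₚ bilinear f p q′)
      ∎
    where
    open ≡-Reasoning
    F : Word → Word → Word → ℚ
    F v u u′ = extendWords (δ v) (f u u′)

  bilinear-scaleˡ : ∀ c p q → bilinear f (scale c p) q ≋ scale c (bilinear f p q)
  bilinear-scaleˡ c p q = ≋-by-extend λ v →
    trans (extend-bilinear (δ v) f (scale c p) q) (trans (extend-scale _ c p)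
      (sym (trans (extend-scale (δ v) c (bilinear f p q)) (cong (c ℚ.*_) (extend-bilinear (δ v) f p q)))))

  bilinear-scaleʳ : ∀ c p q → bilinear f p (scale c q) ≋ scale c (bilinear f p q)
  bilinear-scaleʳ c p q = ≋-by-extend λ v →
    trans (extend-bilinear (δ v) f p (scale c q))
      (trans (extend-congˡ (λ u → extend-scale _ c q) p) (trans (extend-* c _ p)
        (sym (trans (extend-scale (δ v) c (bilinear f p q)) (cong (c ℚ.*_) (extend-bilinear (δ v) f p q))))))

  bilinear-zeroʳ : ∀ p → bilinear f p 0ₚ ≋ 0ₚ
  bilinear-zeroʳ p = ≋-by-extend λ v → trans (extend-bilinear (δ v) f p 0ₚ) (extend-0 p)

concatenate : Word → Word → List Word
concatenate u v = (u ++ v) ∷ []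

·ₚ-as-bilinear : ∀ p q → p ·ₚ q ≡ bilinear concatenate p q
·ₚ-as-bilinear [] q = refl
·ₚ-as-bilinear (s ∷ p) q = cong₂ _++_ (row q) (·ₚ-as-bilinear p q)
  where
  row : ∀ q → map (λ t → (proj₁ s ℚ.* proj₁ t) , (proj₂ s ++ proj₂ t)) q
      ≡ concatMap (λ t → map (λ w → (proj₁ s ℚ.* proj₁ t) , w) (concatenate (proj₂ s) (proj₂ t))) q
  row [] = refl
  row (t ∷ q) = cong (_ ∷_) (row q)

module _ where
  open ≋-Reasoning

  ·ₚ-cong : ∀ {p p′ q q′} → p ≋ p′ → q ≋ q′ → (p ·ₚ q) ≋ (p′ ·ₚ q′)
  ·ₚ-cong {p} {p′} {q} {q′} e e′ = begin
    p ·ₚ q                      ≡⟨ ·ₚ-as-bilinear p q ⟩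
    bilinear concatenate p q    ≈⟨ bilinear-cong concatenate e e′ ⟩
    bilinear concatenate p′ q′  ≡⟨ ·ₚ-as-bilinear p′ q′ ⟨
    p′ ·ₚ q′                    ∎

  ·ₚ-distribˡ : ∀ p q q′ → (p ·ₚ (q +ₚ q′)) ≋ ((p ·ₚ q) +ₚ (p ·ₚ q′))
  ·ₚ-distribˡ p q q′ = begin
    p ·ₚ (q +ₚ q′)                                                 ≡⟨ ·ₚ-as-bilinear p (q +ₚ q′) ⟩
    bilinear concatenate p (q +ₚ q′)                               ≈⟨ bilinear-distribˡ concatenate p q q′ ⟩
    (bilinear concatenate p q +ₚ bilinear concatenate p q′)        ≡⟨ cong₂ _+ₚ_ (·ₚ-as-bilinear p q) (·ₚ-as-bilinear p q′) ⟨
    (p ·ₚ q) +ₚ (p ·ₚ q′)                                          ∎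

  ·ₚ-scaleˡ : ∀ c p q → (scale c p ·ₚ q) ≋ scale c (p ·ₚ q)
  ·ₚ-scaleˡ c p q = begin
    scale c p ·ₚ q                             ≡⟨ ·ₚ-as-bilinear (scale c p) q ⟩
    bilinear concatenate (scale c p) q         ≈⟨ bilinear-scaleˡ concatenate c p q ⟩
    scale c (bilinear concatenate p q)         ≡⟨ cong (scale c) (·ₚ-as-bilinear p q) ⟨
    scale c (p ·ₚ q)                           ∎

  ·ₚ-scaleʳ : ∀ c p q → (p ·ₚ scale c q) ≋ scale c (p ·ₚ q)
  ·ₚ-scaleʳ c p q = begin
    p ·ₚ scale c q                             ≡⟨ ·ₚ-as-bilinear p (scale c q) ⟩
    bilinear concatenate p (scale c q)         ≈⟨ bilinear-scaleʳ concatenate c p q ⟩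
    scale c (bilinear concatenate p q)         ≡⟨ cong (scale c) (·ₚ-as-bilinear p q) ⟨
    scale c (p ·ₚ q)                           ∎

  ·ₚ-congˡ : ∀ p {q q′} → q ≋ q′ → (p ·ₚ q) ≋ (p ·ₚ q′)
  ·ₚ-congˡ p = ·ₚ-cong (≋-refl {p})

  ·ₚ-congʳ : ∀ q {p p′} → p ≋ p′ → (p ·ₚ q) ≋ (p′ ·ₚ q)
  ·ₚ-congʳ q e = ·ₚ-cong e (≋-refl {q})

  ·ₚ-zeroʳ : ∀ p → (p ·ₚ 0ₚ) ≋ 0ₚ
  ·ₚ-zeroʳ p = ≋-trans (≡⇒≋ (·ₚ-as-bilinear p 0ₚ)) (bilinear-zeroʳ concatenate p)

·ₚ-distribʳ : ∀ p p′ q → ((p +ₚ p′) ·ₚ q) ≡ ((p ·ₚ q) +ₚ (p′ ·ₚ q))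
·ₚ-distribʳ p p′ q = List.concatMap-++ _ p p′

·ₚ-assoc : ∀ p q r → ((p ·ₚ q) ·ₚ r) ≡ (p ·ₚ (q ·ₚ r))
·ₚ-assoc [] q r = refl
·ₚ-assoc (s ∷ p) q r = trans (·ₚ-distribʳ (map (s ⊗_) q) (p ·ₚ q) r) (cong₂ _++_ (row q) (·ₚ-assoc p q r))
  where
  _⊗_ : ℚ × Word → ℚ × Word → ℚ × Word
  (c , u) ⊗ (d , v) = (c ℚ.* d) , (u ++ v)
  ⊗-assoc : ∀ s t u → (s ⊗ t) ⊗ u ≡ s ⊗ (t ⊗ u)
  ⊗-assoc (c , u) (d , v) (e , w) = cong₂ _,_ (ℚ.*-assoc c d e) (List.++-assoc u v w)
  row : ∀ q → (map (s ⊗_) q ·ₚ r) ≡ map (s ⊗_) (q ·ₚ r)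
  row [] = refl
  row (t ∷ q) = begin
    map ((s ⊗ t) ⊗_) r ++ (map (s ⊗_) q ·ₚ r)       ≡⟨ cong₂ _++_ (List.map-cong (⊗-assoc s t) r) (row q) ⟩
    map (s ⊗_ ∘ (t ⊗_)) r ++ map (s ⊗_) (q ·ₚ r)    ≡⟨ cong (_++ _) (List.map-∘ r) ⟩
    map (s ⊗_) (map (t ⊗_) r) ++ map (s ⊗_) (q ·ₚ r) ≡⟨ List.map-++ (s ⊗_) (map (t ⊗_) r) (q ·ₚ r) ⟨
    map (s ⊗_) (map (t ⊗_) r ++ (q ·ₚ r))           ∎
    where open ≡-Reasoning

·ₚ-identityˡ : ∀ p → (1ₚ ·ₚ p) ≋ p
·ₚ-identityˡ p = ≡⇒≋ (trans (List.++-identityʳ _)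
  (trans (List.map-cong (λ t → cong (_, proj₂ t) (ℚ.*-identityˡ (proj₁ t))) p) (List.map-id p)))

·ₚ-identityʳ : ∀ p → (p ·ₚ 1ₚ) ≋ p
·ₚ-identityʳ p = ≡⇒≋ (go p)
  where
  go : ∀ p → (p ·ₚ 1ₚ) ≡ p
  go [] = refl
  go ((c , u) ∷ p) = cong₂ _∷_ (cong₂ _,_ (ℚ.*-identityʳ c) (List.++-identityʳ u)) (go p)

extend-prefix : ∀ g l p → extend g (letter l ·ₚ p) ≡ extend (λ u → g (l ∷ u)) p
extend-prefix g l p = trans (extend-+ₚ g (map (λ t → (1ℚ ℚ.* proj₁ t) , (l ∷ proj₂ t)) p) [])
  (trans (ℚ.+-identityʳ _) (go p))
  where
  go : ∀ p → extend g (map (λ t → (1ℚ ℚ.* proj₁ t) , (l ∷ proj₂ t)) p) ≡ extend (λ u → g (l ∷ u)) p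
  go [] = refl
  go ((c , u) ∷ p) = cong₂ ℚ._+_ (cong (ℚ._* g (l ∷ u)) (ℚ.*-identityˡ c)) (go p)

шₚ-cong : ∀ {p p′ q q′} → p ≋ p′ → q ≋ q′ → (p шₚ q) ≋ (p′ шₚ q′)
шₚ-cong = bilinear-cong _ш_

шₚ-congˡ : ∀ p {q q′} → q ≋ q′ → (p шₚ q) ≋ (p шₚ q′)
шₚ-congˡ p = шₚ-cong (≋-refl {p})

шₚ-identityˡ : ∀ q → (1ₚ шₚ q) ≋ q
шₚ-identityˡ q = ≡⇒≋ (trans (List.++-identityʳ _) (go q))
  where
  go : ∀ q → concatMap (λ t → map (λ w → (1ℚ ℚ.* proj₁ t) , w) ([] ш proj₂ t)) q ≡ q
  go [] = refl
  go ((c , u) ∷ q) = cong₂ _∷_ (cong (_, u) (ℚ.*-identityˡ c)) (go q)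

шₚ-identityʳ : ∀ p → (p шₚ 1ₚ) ≋ p
шₚ-identityʳ p = ≡⇒≋ (go p)
  where
  go : ∀ p → (p шₚ 1ₚ) ≡ p
  go [] = refl
  go ((c , []) ∷ p) = cong₂ _∷_ (cong (_, []) (ℚ.*-identityʳ c)) (go p)
  go ((c , a ∷ u) ∷ p) = cong₂ _∷_ (cong (_, a ∷ u) (ℚ.*-identityʳ c)) (go p)

ShuffleRecursive : Poly → Poly → Set
ShuffleRecursive ℓ m = ∀ p q →
  ((ℓ ·ₚ p) шₚ (m ·ₚ q)) ≋ ((ℓ ·ₚ (p шₚ (m ·ₚ q))) +ₚ (m ·ₚ ((ℓ ·ₚ p) шₚ q)))

letter-shuffleRecursive : ∀ l m → ShuffleRecursive (letter l) (letter m)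
letter-shuffleRecursive l m p q = ≋-by-extend λ v → begin
  extend (δ v) ((letter l ·ₚ p) шₚ (letter m ·ₚ q))
    ≡⟨ extend-bilinear (δ v) _ш_ (letter l ·ₚ p) (letter m ·ₚ q) ⟩
  S (δ v) (letter l ·ₚ p) (letter m ·ₚ q)
    ≡⟨ trans (extend-prefix _ l p) (extend-congˡ (λ u → extend-prefix _ m q) p) ⟩
  extend (λ u → extend (λ u′ → extendWords (δ v) ((l ∷ u) ш (m ∷ u′))) q) p
    ≡⟨ extend-congˡ (λ u → extend-congˡ (λ u′ → split v u u′) q) p ⟩
  extend (λ u → extend (λ u′ → extendWords (δ v ∘ (l ∷_)) (u ш (m ∷ u′))
                              ℚ.+ extendWords (δ v ∘ (m ∷_)) ((l ∷ u) ш u′)) q) p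
    ≡⟨ trans (extend-congˡ (λ u → extend-+ _ _ q) p) (extend-+ _ _ p) ⟩
  extend (λ u → extend (λ u′ → extendWords (δ v ∘ (l ∷_)) (u ш (m ∷ u′))) q) p
    ℚ.+ extend (λ u → extend (λ u′ → extendWords (δ v ∘ (m ∷_)) ((l ∷ u) ш u′)) q) p
    ≡⟨ cong₂ ℚ._+_ (extend-congˡ (λ u → extend-prefix _ m q) p) (extend-prefix _ l p) ⟨
  S (δ v ∘ (l ∷_)) p (letter m ·ₚ q) ℚ.+ S (δ v ∘ (m ∷_)) (letter l ·ₚ p) q
    ≡⟨ cong₂ ℚ._+_ (extend-bilinear _ _ш_ p (letter m ·ₚ q)) (extend-bilinear _ _ш_ (letter l ·ₚ p) q) ⟨
  extend (δ v ∘ (l ∷_)) (p шₚ (letter m ·ₚ q)) ℚ.+ extend (δ v ∘ (m ∷_)) ((letter l ·ₚ p) шₚ q)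
    ≡⟨ cong₂ ℚ._+_ (extend-prefix (δ v) l (p шₚ (letter m ·ₚ q))) (extend-prefix (δ v) m ((letter l ·ₚ p) шₚ q)) ⟨
  extend (δ v) (letter l ·ₚ (p шₚ (letter m ·ₚ q))) ℚ.+ extend (δ v) (letter m ·ₚ ((letter l ·ₚ p) шₚ q))
    ≡⟨ extend-+ₚ (δ v) (letter l ·ₚ (p шₚ (letter m ·ₚ q))) _ ⟨
  extend (δ v) ((letter l ·ₚ (p шₚ (letter m ·ₚ q))) +ₚ (letter m ·ₚ ((letter l ·ₚ p) шₚ q)))
    ∎
  where
  open ≡-Reasoning
  S : (Word → ℚ) → Poly → Poly → ℚ
  S g p q = extend (λ u → extend (λ u′ → extendWords g (u ш u′)) q) p
  split : ∀ v u u′ → extendWords (δ v) ((l ∷ u) ш (m ∷ u′))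
        ≡ extendWords (δ v ∘ (l ∷_)) (u ш (m ∷ u′)) ℚ.+ extendWords (δ v ∘ (m ∷_)) ((l ∷ u) ш u′)
  split v u u′ = trans (extendWords-++ (δ v) (map (l ∷_) (u ш (m ∷ u′))) _)
    (cong₂ ℚ._+_ (extendWords-map (δ v) (l ∷_) (u ш (m ∷ u′))) (extendWords-map (δ v) (m ∷_) ((l ∷ u) ш u′)))

module _ where
  open ≋-Reasoning

  shuffleRecursive-+ˡ : ∀ ℓ₁ ℓ₂ m → ShuffleRecursive ℓ₁ m → ShuffleRecursive ℓ₂ m →
                        ShuffleRecursive (ℓ₁ +ₚ ℓ₂) m
  shuffleRecursive-+ˡ ℓ₁ ℓ₂ m rec₁ rec₂ p q = begin
    ((ℓ₁ +ₚ ℓ₂) ·ₚ p) шₚ (m ·ₚ q)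
      ≡⟨ cong (_шₚ (m ·ₚ q)) (·ₚ-distribʳ ℓ₁ ℓ₂ p) ⟩
    ((ℓ₁ ·ₚ p) +ₚ (ℓ₂ ·ₚ p)) шₚ (m ·ₚ q)
      ≡⟨ bilinear-distribʳ _ш_ (ℓ₁ ·ₚ p) (ℓ₂ ·ₚ p) (m ·ₚ q) ⟩
    ((ℓ₁ ·ₚ p) шₚ (m ·ₚ q)) +ₚ ((ℓ₂ ·ₚ p) шₚ (m ·ₚ q))
      ≈⟨ +ₚ-cong (rec₁ p q) (rec₂ p q) ⟩
    ((ℓ₁ ·ₚ r) +ₚ (m ·ₚ ((ℓ₁ ·ₚ p) шₚ q))) +ₚ ((ℓ₂ ·ₚ r) +ₚ (m ·ₚ ((ℓ₂ ·ₚ p) шₚ q)))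
      ≈⟨ +ₚ-interchange (ℓ₁ ·ₚ r) _ (ℓ₂ ·ₚ r) _ ⟩
    ((ℓ₁ ·ₚ r) +ₚ (ℓ₂ ·ₚ r)) +ₚ ((m ·ₚ ((ℓ₁ ·ₚ p) шₚ q)) +ₚ (m ·ₚ ((ℓ₂ ·ₚ p) шₚ q)))
      ≈⟨ +ₚ-cong (≡⇒≋ (sym (·ₚ-distribʳ ℓ₁ ℓ₂ r))) (≋-sym (·ₚ-distribˡ m _ _)) ⟩
    ((ℓ₁ +ₚ ℓ₂) ·ₚ r) +ₚ (m ·ₚ (((ℓ₁ ·ₚ p) шₚ q) +ₚ ((ℓ₂ ·ₚ p) шₚ q)))
      ≡⟨ cong (λ s → ((ℓ₁ +ₚ ℓ₂) ·ₚ r) +ₚ (m ·ₚ s))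
              (trans (cong (_шₚ q) (·ₚ-distribʳ ℓ₁ ℓ₂ p)) (bilinear-distribʳ _ш_ (ℓ₁ ·ₚ p) (ℓ₂ ·ₚ p) q)) ⟨
    ((ℓ₁ +ₚ ℓ₂) ·ₚ r) +ₚ (m ·ₚ (((ℓ₁ +ₚ ℓ₂) ·ₚ p) шₚ q))
      ∎
    where
    r = p шₚ (m ·ₚ q)

  shuffleRecursive-scaleʳ : ∀ ℓ m c → ShuffleRecursive ℓ m → ShuffleRecursive ℓ (scale c m)
  shuffleRecursive-scaleʳ ℓ m c rec p q = begin
    (ℓ ·ₚ p) шₚ (scale c m ·ₚ q)
      ≈⟨ шₚ-congˡ (ℓ ·ₚ p) (·ₚ-scaleˡ c m q) ⟩
    (ℓ ·ₚ p) шₚ scale c (m ·ₚ q)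
      ≈⟨ bilinear-scaleʳ _ш_ c (ℓ ·ₚ p) (m ·ₚ q) ⟩
    scale c ((ℓ ·ₚ p) шₚ (m ·ₚ q))
      ≈⟨ scale-cong c (rec p q) ⟩
    scale c ((ℓ ·ₚ (p шₚ (m ·ₚ q))) +ₚ (m ·ₚ ((ℓ ·ₚ p) шₚ q)))
      ≡⟨ scale-+ₚ c (ℓ ·ₚ (p шₚ (m ·ₚ q))) _ ⟩
    scale c (ℓ ·ₚ (p шₚ (m ·ₚ q))) +ₚ scale c (m ·ₚ ((ℓ ·ₚ p) шₚ q))
      ≈⟨ +ₚ-cong (≋-sym (·ₚ-scaleʳ c ℓ _)) (≋-sym (·ₚ-scaleˡ c m _)) ⟩
    (ℓ ·ₚ scale c (p шₚ (m ·ₚ q))) +ₚ (scale c m ·ₚ ((ℓ ·ₚ p) шₚ q))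
      ≈⟨ +ₚ-congʳ _ (·ₚ-congˡ ℓ (≋-sym (bilinear-scaleʳ _ш_ c p (m ·ₚ q)))) ⟩
    (ℓ ·ₚ (p шₚ scale c (m ·ₚ q))) +ₚ (scale c m ·ₚ ((ℓ ·ₚ p) шₚ q))
      ≈⟨ +ₚ-congʳ _ (·ₚ-congˡ ℓ (шₚ-congˡ p (≋-sym (·ₚ-scaleˡ c m q)))) ⟩
    (ℓ ·ₚ (p шₚ (scale c m ·ₚ q))) +ₚ (scale c m ·ₚ ((ℓ ·ₚ p) шₚ q))
      ∎

∑ : ℕ → (ℕ → Poly) → Poly
∑ zero f = 0ₚ
∑ (suc n) f = f 0 +ₚ ∑ n (f ∘ suc)

∑-cong-≡ : ∀ n {f g : ℕ → Poly} → (∀ i → f i ≡ g i) → ∑ n f ≡ ∑ n g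
∑-cong-≡ zero e = refl
∑-cong-≡ (suc n) e = cong₂ _+ₚ_ (e 0) (∑-cong-≡ n (e ∘ suc))

∑-cong : ∀ n {f g : ℕ → Poly} → (∀ i → i ℕ.< n → f i ≋ g i) → ∑ n f ≋ ∑ n g
∑-cong zero e = ≋-refl
∑-cong (suc n) e = +ₚ-cong (e 0 (s≤s z≤n)) (∑-cong n (λ i i<n → e (suc i) (s≤s i<n)))

∑-null : ∀ n (f : ℕ → Poly) → (∀ i → i ℕ.< n → f i ≋ 0ₚ) → ∑ n f ≋ 0ₚ
∑-null zero f e = ≋-refl
∑-null (suc n) f e = +ₚ-cong (e 0 (s≤s z≤n)) (∑-null n (f ∘ suc) (λ i i<n → e (suc i) (s≤s i<n)))

∑-single : ∀ n (f : ℕ → Poly) k → k ℕ.< n → (∀ i → i ℕ.< n → ¬ i ≡ k → f i ≋ 0ₚ) → ∑ n f ≋ f k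
∑-single (suc n) f zero _ e =
  ≋-trans (+ₚ-congˡ (f 0) (∑-null n (f ∘ suc) (λ i i<n → e (suc i) (s≤s i<n) λ ()))) (+ₚ-identityʳ (f 0))
∑-single (suc n) f (suc k) (s≤s k<n) e =
  +ₚ-cong (e 0 (s≤s z≤n) λ ()) (∑-single n (f ∘ suc) k k<n (λ i i<n i≢k → e (suc i) (s≤s i<n) (i≢k ∘ ℕ.suc-injective)))

∑-head : ∀ n (f : ℕ → Poly) → (∀ i → f (suc i) ≋ 0ₚ) → ∑ (suc n) f ≋ f 0
∑-head n f f-null = ≋-trans (+ₚ-congˡ (f 0) (∑-null n (f ∘ suc) (λ i _ → f-null i))) (+ₚ-identityʳ (f 0))

∑-+ₚ : ∀ n (f g : ℕ → Poly) → ∑ n (λ i → f i +ₚ g i) ≋ (∑ n f +ₚ ∑ n g)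
∑-+ₚ zero f g = ≋-refl
∑-+ₚ (suc n) f g = ≋-trans (+ₚ-congˡ (f 0 +ₚ g 0) (∑-+ₚ n (f ∘ suc) (g ∘ suc)))
                           (+ₚ-interchange (f 0) (g 0) (∑ n (f ∘ suc)) (∑ n (g ∘ suc)))

∑-scale : ∀ c n (f : ℕ → Poly) → scale c (∑ n f) ≋ ∑ n (λ i → scale c (f i))
∑-scale c zero f = ≋-refl
∑-scale c (suc n) f = ≋-trans (≡⇒≋ (scale-+ₚ c (f 0) _)) (+ₚ-congˡ (scale c (f 0)) (∑-scale c n (f ∘ suc)))

∑-·ₚˡ : ∀ p n (f : ℕ → Poly) → (p ·ₚ ∑ n f) ≋ ∑ n (λ i → p ·ₚ f i)
∑-·ₚˡ p zero f = ·ₚ-zeroʳ p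
∑-·ₚˡ p (suc n) f = ≋-trans (·ₚ-distribˡ p (f 0) _) (+ₚ-congˡ (p ·ₚ f 0) (∑-·ₚˡ p n (f ∘ suc)))

∑-swap : ∀ n m (f : ℕ → ℕ → Poly) → ∑ n (λ i → ∑ m (f i)) ≋ ∑ m (λ j → ∑ n (λ i → f i j))
∑-swap zero m f = ≋-sym (∑-null m _ (λ _ _ → ≋-refl))
∑-swap (suc n) m f = ≋-trans (+ₚ-congˡ (∑ m (f 0)) (∑-swap n m (f ∘ suc)))
                             (≋-sym (∑-+ₚ m (f 0) (λ j → ∑ n (λ i → f (suc i) j))))

∑-last : ∀ n (f : ℕ → Poly) → ∑ (suc n) f ≋ (∑ n f +ₚ f n)
∑-last zero f = +ₚ-identityʳ (f 0)
∑-last (suc n) f = ≋-trans (+ₚ-congˡ (f 0) (∑-last n (f ∘ suc))) (≡⇒≋ (sym (List.++-assoc (f 0) _ _)))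

∑-pad : ∀ k n (f : ℕ → Poly) → k ℕ.≤ n → (∀ i → k ℕ.≤ i → i ℕ.< n → f i ≋ 0ₚ) → ∑ n f ≋ ∑ k f
∑-pad k zero f z≤n _ = ≋-refl
∑-pad k (suc n) f k≤1+n e with ℕ.m≤n⇒m<n∨m≡n k≤1+n
... | inj₂ refl = ≋-refl
... | inj₁ (s≤s k≤n) = begin
  ∑ (suc n) f     ≈⟨ ∑-last n f ⟩
  ∑ n f +ₚ f n    ≈⟨ +ₚ-cong (∑-pad k n f k≤n (λ i k≤i i<n → e i k≤i (ℕ.m≤n⇒m≤1+n i<n))) (e n k≤n ℕ.≤-refl) ⟩
  ∑ k f +ₚ 0ₚ     ≈⟨ +ₚ-identityʳ (∑ k f) ⟩
  ∑ k f           ∎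
  where open ≋-Reasoning

when-≤ : ℕ → ℕ → Poly → Poly
when-≤ m n p with m ℕ.≤? n
... | yes _ = p
... | no _ = 0ₚ

∑-truncate : ∀ b j (f : ℕ → Poly) → j ℕ.≤ b →
             ∑ (suc b) (λ i → when-≤ (i ℕ.+ j) b (f i)) ≋ ∑ (suc (b ∸ j)) f
∑-truncate b j f j≤b = ≋-trans (∑-pad (suc (b ∸ j)) (suc b) _ (s≤s (ℕ.m∸n≤m b j)) beyond)
                               (∑-cong (suc (b ∸ j)) within)
  where
  beyond : ∀ i → suc (b ∸ j) ℕ.≤ i → i ℕ.< suc b → when-≤ (i ℕ.+ j) b (f i) ≋ 0ₚ
  beyond i b∸j<i _ with i ℕ.+ j ℕ.≤? b
  ... | no _ = ≋-refl
  ... | yes i+j≤b = ⊥-elim (ℕ.<⇒≱ b∸j<i (ℕ.m+n≤o⇒m≤o∸n i i+j≤b))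
  within : ∀ i → i ℕ.< suc (b ∸ j) → when-≤ (i ℕ.+ j) b (f i) ≋ f i
  within i (s≤s i≤b∸j) with i ℕ.+ j ℕ.≤? b
  ... | yes _ = ≋-refl
  ... | no i+j≰b = ⊥-elim (i+j≰b (ℕ.m≤o∸n⇒m+n≤o i j≤b i≤b∸j))

∑-triangle-swap : ∀ b (h : ℕ → ℕ → Poly) →
  ∑ (suc b) (λ j → ∑ (suc (b ∸ j)) (λ i → h i j)) ≋ ∑ (suc b) (λ i → ∑ (suc (b ∸ i)) (h i))
∑-triangle-swap b h = begin
  ∑ (suc b) (λ j → ∑ (suc (b ∸ j)) (λ i → h i j))
    ≈⟨ ∑-cong (suc b) (λ j j≤b → ∑-truncate b j (λ i → h i j) (ℕ.≤-pred j≤b)) ⟨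
  ∑ (suc b) (λ j → ∑ (suc b) (λ i → when-≤ (i ℕ.+ j) b (h i j)))
    ≈⟨ ∑-swap (suc b) (suc b) (λ j i → when-≤ (i ℕ.+ j) b (h i j)) ⟩
  ∑ (suc b) (λ i → ∑ (suc b) (λ j → when-≤ (i ℕ.+ j) b (h i j)))
    ≡⟨ ∑-cong-≡ (suc b) (λ i → ∑-cong-≡ (suc b) (λ j → cong (λ m → when-≤ m b (h i j)) (ℕ.+-comm i j))) ⟩
  ∑ (suc b) (λ i → ∑ (suc b) (λ j → when-≤ (j ℕ.+ i) b (h i j)))
    ≈⟨ ∑-cong (suc b) (λ i i≤b → ∑-truncate b i (h i) (ℕ.≤-pred i≤b)) ⟩
  ∑ (suc b) (λ i → ∑ (suc (b ∸ i)) (h i))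
    ∎
  where open ≋-Reasoning

sumP-++ : ∀ ps qs → sumP (ps ++ qs) ≡ (sumP ps +ₚ sumP qs)
sumP-++ [] qs = refl
sumP-++ (p ∷ ps) qs = trans (cong (p ++_) (sumP-++ ps qs)) (sym (List.++-assoc p (sumP ps) (sumP qs)))

sumP-concatMap : ∀ {A : Set} (h : A → List Poly) xs → sumP (concatMap h xs) ≡ sumP (map (sumP ∘ h) xs)
sumP-concatMap h [] = refl
sumP-concatMap h (a ∷ xs) = trans (sumP-++ (h a) (concatMap h xs)) (cong (sumP (h a) ++_) (sumP-concatMap h xs))

sumP-applyUpTo : ∀ (f : ℕ → Poly) g n → sumP (map f (applyUpTo g n)) ≡ ∑ n (f ∘ g)
sumP-applyUpTo f g zero = refl
sumP-applyUpTo f g (suc n) = cong (f (g 0) ++_) (sumP-applyUpTo f (g ∘ suc) n)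

sumP-grid : ∀ (h : ℕ → ℕ → Poly) a b →
  sumP (concatMap (λ i → map (h i) (upTo (suc b))) (upTo (suc a))) ≡ ∑ (suc a) (λ i → ∑ (suc b) (h i))
sumP-grid h a b = begin
  sumP (concatMap (λ i → map (h i) (upTo (suc b))) (upTo (suc a)))    ≡⟨ sumP-concatMap (λ i → map (h i) (upTo (suc b))) (upTo (suc a)) ⟩
  sumP (map (λ i → sumP (map (h i) (upTo (suc b)))) (upTo (suc a)))   ≡⟨ sumP-applyUpTo _ (λ i → i) (suc a) ⟩
  ∑ (suc a) (λ i → sumP (map (h i) (upTo (suc b))))                   ≡⟨ ∑-cong-≡ (suc a) (λ i → sumP-applyUpTo (h i) (λ j → j) (suc b)) ⟩
  ∑ (suc a) (λ i → ∑ (suc b) (h i))                                   ∎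
  where open ≡-Reasoning

∑-antidiagonal : ∀ b (f : ℕ → ℕ → Poly) → (∀ j k → f j (suc k) ≋ 0ₚ) →
                 ∑ (suc b) (λ j → f j (b ∸ j)) ≋ f b 0
∑-antidiagonal b f f-null = ≋-trans (∑-single (suc b) _ b ℕ.≤-refl off) (≡⇒≋ (cong (f b) (ℕ.n∸n≡0 b)))
  where
  off : ∀ j → j ℕ.< suc b → ¬ j ≡ b → f j (b ∸ j) ≋ 0ₚ
  off j (s≤s j≤b) j≢b with b ∸ j in eq
  ... | suc k = f-null j k
  ... | zero = ⊥-elim (j≢b (ℕ.≤-antisym j≤b (ℕ.m∸n≡0⇒m≤n eq)))

conv-as-∑ : ∀ _⊙_ S T a b →
  conv _⊙_ S T a b ≡ ∑ (suc a) (λ i → ∑ (suc b) (λ j → S i j ⊙ T (a ∸ i) (b ∸ j)))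
conv-as-∑ _⊙_ S T a b = sumP-grid (λ i j → S i j ⊙ T (a ∸ i) (b ∸ j)) a b

module _ (_⊙_ : Poly → Poly → Poly) where
  open ≋-Reasoning

  conv-constʳ : (∀ p → (p ⊙ 0ₚ) ≋ 0ₚ) → ∀ S q a b → conv _⊙_ S (const q) a b ≋ (S a b ⊙ q)
  conv-constʳ zeroʳ S q a b = begin
    conv _⊙_ S (const q) a b
      ≡⟨ conv-as-∑ _⊙_ S (const q) a b ⟩
    ∑ (suc a) (λ i → ∑ (suc b) (λ j → S i j ⊙ const q (a ∸ i) (b ∸ j)))
      ≈⟨ ∑-antidiagonal a (λ i k → ∑ (suc b) (λ j → S i j ⊙ const q k (b ∸ j)))
                          (λ i k → ∑-null (suc b) _ (λ j _ → zeroʳ (S i j))) ⟩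
    ∑ (suc b) (λ j → S a j ⊙ const q 0 (b ∸ j))
      ≈⟨ ∑-antidiagonal b (λ j k → S a j ⊙ const q 0 k) (λ j k → zeroʳ (S a j)) ⟩
    S a b ⊙ q
      ∎

  module _ (zeroˡ : ∀ q → (0ₚ ⊙ q) ≡ 0ₚ) where

    conv-constˡ : ∀ p T a b → conv _⊙_ (const p) T a b ≋ (p ⊙ T a b)
    conv-constˡ p T a b = begin
      conv _⊙_ (const p) T a b
        ≡⟨ conv-as-∑ _⊙_ (const p) T a b ⟩
      ∑ (suc a) (λ i → ∑ (suc b) (λ j → const p i j ⊙ T (a ∸ i) (b ∸ j)))
        ≈⟨ ∑-head a (λ i → ∑ (suc b) (λ j → const p i j ⊙ T (a ∸ i) (b ∸ j)))
                   (λ i → ∑-null (suc b) _ (λ j _ → ≡⇒≋ (zeroˡ (T (a ∸ suc i) (b ∸ j))))) ⟩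
      ∑ (suc b) (λ j → const p 0 j ⊙ T a (b ∸ j))
        ≈⟨ ∑-head b (λ j → const p 0 j ⊙ T a (b ∸ j)) (λ j → ≡⇒≋ (zeroˡ (T a (b ∸ suc j)))) ⟩
      p ⊙ T a b
        ∎

    conv-monoX-suc : ∀ i j p T a b → conv _⊙_ (mono (suc i) j p) T (suc a) b ≋ conv _⊙_ (mono i j p) T a b
    conv-monoX-suc i j p T a b = begin
      conv _⊙_ (mono (suc i) j p) T (suc a) b
        ≡⟨ conv-as-∑ _⊙_ (mono (suc i) j p) T (suc a) b ⟩
      ∑ (suc b) (λ l → 0ₚ ⊙ T (suc a) (b ∸ l)) +ₚ ∑ (suc a) (λ k → ∑ (suc b) (λ l → mono i j p k l ⊙ T (a ∸ k) (b ∸ l)))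
        ≈⟨ +ₚ-congʳ _ (∑-null (suc b) _ (λ l _ → ≡⇒≋ (zeroˡ (T (suc a) (b ∸ l))))) ⟩
      ∑ (suc a) (λ k → ∑ (suc b) (λ l → mono i j p k l ⊙ T (a ∸ k) (b ∸ l)))
        ≡⟨ conv-as-∑ _⊙_ (mono i j p) T a b ⟨
      conv _⊙_ (mono i j p) T a b
        ∎

    conv-monoX-zero : ∀ i j p T b → conv _⊙_ (mono (suc i) j p) T 0 b ≋ 0ₚ
    conv-monoX-zero i j p T b = begin
      conv _⊙_ (mono (suc i) j p) T 0 b              ≡⟨ conv-as-∑ _⊙_ (mono (suc i) j p) T 0 b ⟩
      ∑ (suc b) (λ l → 0ₚ ⊙ T 0 (b ∸ l)) +ₚ 0ₚ       ≈⟨ +ₚ-identityʳ _ ⟩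
      ∑ (suc b) (λ l → 0ₚ ⊙ T 0 (b ∸ l))             ≈⟨ ∑-null (suc b) _ (λ l _ → ≡⇒≋ (zeroˡ (T 0 (b ∸ l)))) ⟩
      0ₚ                                             ∎

    conv-monoY-suc : ∀ j p T a b → conv _⊙_ (mono 0 (suc j) p) T a (suc b) ≋ conv _⊙_ (mono 0 j p) T a b
    conv-monoY-suc j p T a b = begin
      conv _⊙_ (mono 0 (suc j) p) T a (suc b)
        ≡⟨ conv-as-∑ _⊙_ (mono 0 (suc j) p) T a (suc b) ⟩
      ∑ (suc a) (λ k → (0ₚ ⊙ T (a ∸ k) (suc b)) +ₚ ∑ (suc b) (λ l → mono 0 j p k l ⊙ T (a ∸ k) (b ∸ l)))
        ≡⟨ ∑-cong-≡ (suc a) (λ k → cong (_+ₚ ∑ (suc b) (λ l → mono 0 j p k l ⊙ T (a ∸ k) (b ∸ l))) (zeroˡ (T (a ∸ k) (suc b)))) ⟩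
      ∑ (suc a) (λ k → ∑ (suc b) (λ l → mono 0 j p k l ⊙ T (a ∸ k) (b ∸ l)))
        ≡⟨ conv-as-∑ _⊙_ (mono 0 j p) T a b ⟨
      conv _⊙_ (mono 0 j p) T a b
        ∎

    conv-monoY-zero : ∀ j p T a → conv _⊙_ (mono 0 (suc j) p) T a 0 ≋ 0ₚ
    conv-monoY-zero j p T a = begin
      conv _⊙_ (mono 0 (suc j) p) T a 0                ≡⟨ conv-as-∑ _⊙_ (mono 0 (suc j) p) T a 0 ⟩
      ∑ (suc a) (λ k → (0ₚ ⊙ T (a ∸ k) 0) +ₚ 0ₚ)       ≈⟨ ∑-null (suc a) _ (λ k _ → ≋-trans (+ₚ-identityʳ _) (≡⇒≋ (zeroˡ (T (a ∸ k) 0)))) ⟩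
      0ₚ                                               ∎

infixr 30 _^ₚ_
_^ₚ_ : Poly → ℕ → Poly
p ^ₚ zero = 1ₚ
p ^ₚ suc m = p ·ₚ p ^ₚ m

·ₚ-mono : ∀ p i j q a b → (p ·ₚ mono i j q a b) ≋ mono i j (p ·ₚ q) a b
·ₚ-mono p zero zero q zero zero = ≋-refl
·ₚ-mono p zero zero q zero (suc b) = ·ₚ-zeroʳ p
·ₚ-mono p zero zero q (suc a) b = ·ₚ-zeroʳ p
·ₚ-mono p zero (suc j) q a zero = ·ₚ-zeroʳ p
·ₚ-mono p zero (suc j) q a (suc b) = ·ₚ-mono p zero j q a b
·ₚ-mono p (suc i) j q zero b = ·ₚ-zeroʳ p
·ₚ-mono p (suc i) j q (suc a) b = ·ₚ-mono p i j q a b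

monoX-off : ∀ m q a b → ¬ m ≡ a → mono m 0 q a b ≡ 0ₚ
monoX-off zero q zero b m≢a = ⊥-elim (m≢a refl)
monoX-off zero q (suc a) b m≢a = refl
monoX-off (suc m) q zero b m≢a = refl
monoX-off (suc m) q (suc a) b m≢a = monoX-off m q a b (m≢a ∘ cong suc)

monoX-diag : ∀ q a b → mono a 0 q a b ≡ const q 0 b
monoX-diag q zero b = refl
monoX-diag q (suc a) b = monoX-diag q a b

monoY-off : ∀ m q a b → ¬ m ≡ b → mono 0 m q a b ≡ 0ₚ
monoY-off zero q a zero m≢b = ⊥-elim (m≢b refl)
monoY-off zero q zero (suc b) m≢b = refl
monoY-off zero q (suc a) (suc b) m≢b = refl
monoY-off (suc m) q a zero m≢b = refl
monoY-off (suc m) q a (suc b) m≢b = monoY-off m q a b (m≢b ∘ cong suc)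

monoY-diag : ∀ q a b → mono 0 b q a b ≡ const q a 0
monoY-diag q a zero = refl
monoY-diag q a (suc b) = monoY-diag q a b

·ₚ-zeroˡ : ∀ q → (0ₚ ·ₚ q) ≡ 0ₚ
·ₚ-zeroˡ q = refl

pow-monoX : ∀ p m a b → pow (mono 1 0 p) m a b ≋ mono m 0 (p ^ₚ m) a b
pow-monoX p zero a b = ≋-refl
pow-monoX p (suc m) zero b = conv-monoX-zero _·ₚ_ ·ₚ-zeroˡ 0 0 p (pow (mono 1 0 p) m) b
pow-monoX p (suc m) (suc a) b = begin
  conv _·ₚ_ (mono 1 0 p) (pow (mono 1 0 p) m) (suc a) b     ≈⟨ conv-monoX-suc _·ₚ_ ·ₚ-zeroˡ 0 0 p (pow (mono 1 0 p) m) a b ⟩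
  conv _·ₚ_ (const p) (pow (mono 1 0 p) m) a b              ≈⟨ conv-constˡ _·ₚ_ ·ₚ-zeroˡ p (pow u m) a b ⟩
  p ·ₚ pow (mono 1 0 p) m a b                               ≈⟨ ·ₚ-congˡ p (pow-monoX p m a b) ⟩
  p ·ₚ mono m 0 (p ^ₚ m) a b                                ≈⟨ ·ₚ-mono p m 0 (p ^ₚ m) a b ⟩
  mono m 0 (p ^ₚ suc m) a b                                 ∎
  where
  open ≋-Reasoning
  u = mono 1 0 p

pow-monoY : ∀ p m a b → pow (mono 0 1 p) m a b ≋ mono 0 m (p ^ₚ m) a b
pow-monoY p zero a b = ≋-refl
pow-monoY p (suc m) a zero = conv-monoY-zero _·ₚ_ ·ₚ-zeroˡ 0 p (pow (mono 0 1 p) m) a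
pow-monoY p (suc m) a (suc b) = begin
  conv _·ₚ_ (mono 0 1 p) (pow (mono 0 1 p) m) a (suc b)     ≈⟨ conv-monoY-suc _·ₚ_ ·ₚ-zeroˡ 0 p (pow (mono 0 1 p) m) a b ⟩
  conv _·ₚ_ (const p) (pow (mono 0 1 p) m) a b              ≈⟨ conv-constˡ _·ₚ_ ·ₚ-zeroˡ p (pow u m) a b ⟩
  p ·ₚ pow (mono 0 1 p) m a b                               ≈⟨ ·ₚ-congˡ p (pow-monoY p m a b) ⟩
  p ·ₚ mono 0 m (p ^ₚ m) a b                                ≈⟨ ·ₚ-mono p 0 m (p ^ₚ m) a b ⟩
  mono 0 m (p ^ₚ suc m) a b                                 ∎
  where
  open ≋-Reasoning
  u = mono 0 1 p

geom-as-∑ : ∀ u a b → geom u a b ≡ ∑ (suc (a ℕ.+ b)) (λ m → pow u m a b)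
geom-as-∑ u a b = sumP-applyUpTo (λ m → pow u m a b) (λ m → m) (suc (a ℕ.+ b))

geom-monoX : ∀ p a b → geom (mono 1 0 p) a b ≋ const (p ^ₚ a) 0 b
geom-monoX p a b = begin
  geom (mono 1 0 p) a b                                ≡⟨ geom-as-∑ (mono 1 0 p) a b ⟩
  ∑ (suc (a ℕ.+ b)) (λ m → pow (mono 1 0 p) m a b)     ≈⟨ ∑-cong (suc (a ℕ.+ b)) (λ m _ → pow-monoX p m a b) ⟩
  ∑ (suc (a ℕ.+ b)) (λ m → mono m 0 (p ^ₚ m) a b)      ≈⟨ ∑-single _ _ a (s≤s (ℕ.m≤m+n a b)) (λ m _ m≢a → ≡⇒≋ (monoX-off m (p ^ₚ m) a b m≢a)) ⟩
  mono a 0 (p ^ₚ a) a b                                ≡⟨ monoX-diag (p ^ₚ a) a b ⟩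
  const (p ^ₚ a) 0 b                                   ∎
  where open ≋-Reasoning

geom-monoY : ∀ p a b → geom (mono 0 1 p) a b ≋ const (p ^ₚ b) a 0
geom-monoY p a b = begin
  geom (mono 0 1 p) a b                                ≡⟨ geom-as-∑ (mono 0 1 p) a b ⟩
  ∑ (suc (a ℕ.+ b)) (λ m → pow (mono 0 1 p) m a b)     ≈⟨ ∑-cong (suc (a ℕ.+ b)) (λ m _ → pow-monoY p m a b) ⟩
  ∑ (suc (a ℕ.+ b)) (λ m → mono 0 m (p ^ₚ m) a b)      ≈⟨ ∑-single _ _ b (s≤s (ℕ.m≤n+m b a)) (λ m _ m≢b → ≡⇒≋ (monoY-off m (p ^ₚ m) a b m≢b)) ⟩
  mono 0 b (p ^ₚ b) a b                                ≡⟨ monoY-diag (p ^ₚ b) a b ⟩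
  const (p ^ₚ b) a 0                                   ∎
  where open ≋-Reasoning

-y : Poly
-y = -ₚ letter y

Φletter-y : ∀ a b → Φletter y a b ≋ ((z ·ₚ const (-y ^ₚ b) a 0) +ₚ (-ₚ const (letter x) a b))
Φletter-y a b = +ₚ-congʳ (-ₚ const (letter x) a b)
  (≋-trans (conv-constˡ _·ₚ_ ·ₚ-zeroˡ z (geom -yY) a b) (·ₚ-congˡ z (geom-monoY -y a b)))

Φletter-X-free : ∀ l a b → Φletter l (suc a) b ≋ 0ₚ
Φletter-X-free x a b = ≋-refl
Φletter-X-free y a b = ≋-trans (Φletter-y (suc a) b) (+ₚ-congʳ 0ₚ (·ₚ-zeroʳ z))

-- The Y^i-coefficients of Φ(z) = z/(1+yY) and of Φ(-y) = x - Φ(z).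
Φz : ℕ → Poly
Φz i = z ·ₚ -y ^ₚ i

Φ-y : ℕ → Poly
Φ-y zero = -y
Φ-y (suc i) = -ₚ Φz (suc i)

Φletter-y-0 : Φletter y 0 0 ≋ letter y
Φletter-y-0 = begin
  Φletter y 0 0                        ≈⟨ Φletter-y 0 0 ⟩
  (z ·ₚ 1ₚ) +ₚ (-ₚ letter x)            ≈⟨ +ₚ-congʳ (-ₚ letter x) (·ₚ-identityʳ z) ⟩
  z +ₚ (-ₚ letter x)                   ≈⟨ coeffwise cancel-x ⟩
  letter y                             ∎
  where
  open ≋-Reasoning
  cancel-x : ∀ w → coeff (z +ₚ (-ₚ letter x)) w ≡ coeff (letter y) w
  cancel-x w = trans (coeff-+ₚ z (-ₚ letter x) w)
    (trans (cong₂ ℚ._+_ (coeff-+ₚ (letter x) (letter y) w) (coeff-scale (ℚ.- 1ℚ) (letter x) w))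
      (solve 2 (λ a b → (a :+ b) :+ con (ℚ.- 1ℚ) :* a := b) refl (coeff (letter x) w) (coeff (letter y) w)))

Φletter-y-suc : ∀ i → Φletter y 0 (suc i) ≋ Φz (suc i)
Φletter-y-suc i = ≋-trans (Φletter-y 0 (suc i)) (+ₚ-identityʳ (Φz (suc i)))

Φz-coeff : ∀ i → (Φletter x 0 i +ₚ Φletter y 0 i) ≋ Φz i
Φz-coeff zero = ≋-trans (+ₚ-congˡ (letter x) Φletter-y-0) (≋-sym (·ₚ-identityʳ z))
Φz-coeff (suc i) = Φletter-y-suc i

Φ-y-coeff : ∀ i → (-ₚ Φletter y 0 i) ≋ Φ-y i
Φ-y-coeff zero = scale-cong (ℚ.- 1ℚ) Φletter-y-0
Φ-y-coeff (suc i) = scale-cong (ℚ.- 1ℚ) (Φletter-y-suc i)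

Φword-X-free : ∀ w a b → Φword w (suc a) b ≋ 0ₚ
Φword-X-free [] a b = ≋-refl
Φword-X-free (l ∷ w) a b =
  ≋-trans (≡⇒≋ (conv-as-∑ _·ₚ_ (Φletter l) (Φword w) (suc a) b)) (∑-null (suc (suc a)) _ term-null)
  where
  term-null : ∀ i → i ℕ.< suc (suc a) →
              ∑ (suc b) (λ j → Φletter l i j ·ₚ Φword w (suc a ∸ i) (b ∸ j)) ≋ 0ₚ
  term-null zero _ = ∑-null (suc b) _ (λ j _ →
    ≋-trans (·ₚ-congˡ (Φletter l 0 j) (Φword-X-free w a (b ∸ j))) (·ₚ-zeroʳ (Φletter l 0 j)))
  term-null (suc i) _ = ∑-null (suc b) _ (λ j _ →
    ·ₚ-congʳ (Φword w (a ∸ i) (b ∸ j)) (Φletter-X-free l i j))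

Φpoly-as-extend : ∀ p a b v → coeff (Φpoly p a b) v ≡ extend (λ u → coeff (Φword u a b) v) p
Φpoly-as-extend [] a b v = refl
Φpoly-as-extend ((c , u) ∷ p) a b v = trans (coeff-+ₚ (scale c (Φword u a b)) _ v)
  (cong₂ ℚ._+_ (coeff-scale c (Φword u a b) v) (Φpoly-as-extend p a b v))

Φpoly-cong : ∀ {p q} a b → p ≋ q → Φpoly p a b ≋ Φpoly q a b
Φpoly-cong {p} {q} a b e = coeffwise λ v →
  trans (Φpoly-as-extend p a b v) (trans (extend-resp _ e) (sym (Φpoly-as-extend q a b v)))

Φpoly-+ₚ : ∀ p q a b → Φpoly (p +ₚ q) a b ≡ (Φpoly p a b +ₚ Φpoly q a b)
Φpoly-+ₚ p q a b = trans (cong sumP (List.map-++ _ p q)) (sumP-++ (map _ p) (map _ q))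

Φpoly-scale : ∀ c p a b → Φpoly (scale c p) a b ≋ scale c (Φpoly p a b)
Φpoly-scale c p a b = coeffwise λ v → trans (Φpoly-as-extend (scale c p) a b v) (trans (extend-scale _ c p)
  (sym (trans (coeff-scale c (Φpoly p a b) v) (cong (c ℚ.*_) (Φpoly-as-extend p a b v)))))

Φpoly-X-free : ∀ p a b → Φpoly p (suc a) b ≋ 0ₚ
Φpoly-X-free p a b = coeffwise λ v → trans (Φpoly-as-extend p (suc a) b v)
  (trans (extend-congˡ (λ u → same-coeff (Φword-X-free u a b) v) p) (extend-0 p))

Φ₀ : Poly → ℕ → Poly
Φ₀ p = Φpoly p 0

-- ΦY F b is the Y^b-coefficient of Φ(Σⱼ F j Yʲ).
ΦY : (ℕ → Poly) → ℕ → Poly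
ΦY F b = ∑ (suc b) (λ j → Φ₀ (F j) (b ∸ j))

Φ-coeff : ∀ S a b → Φ S a b ≋ ΦY (S a) b
Φ-coeff S a b = ≋-trans (≡⇒≋ (sumP-grid (λ i j → Φpoly (S i j) (a ∸ i) (b ∸ j)) a b))
  (∑-antidiagonal a (λ i k → ∑ (suc b) (λ j → Φpoly (S i j) k (b ∸ j)))
                    (λ i k → ∑-null (suc b) _ (λ j _ → Φpoly-X-free (S i j) k (b ∸ j))))

ΦMulˡ : Poly → (ℕ → Poly) → Set
ΦMulˡ ℓ φ = ∀ p k → Φ₀ (ℓ ·ₚ p) k ≋ ∑ (suc k) (λ i → φ i ·ₚ Φ₀ p (k ∸ i))

ΦMulˡ-letter : ∀ l → ΦMulˡ (letter l) (λ i → Φletter l 0 i)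
ΦMulˡ-letter l [] k = ≋-sym (∑-null (suc k) _ (λ i _ → ·ₚ-zeroʳ (Φletter l 0 i)))
ΦMulˡ-letter l ((c , u) ∷ p) k = begin
  scale (1ℚ ℚ.* c) (Φword (l ∷ u) 0 k) +ₚ Φ₀ (letter l ·ₚ p) k
    ≈⟨ +ₚ-cong (≡⇒≋ (cong (λ d → scale d (Φword (l ∷ u) 0 k)) (ℚ.*-identityˡ c))) (ΦMulˡ-letter l p k) ⟩
  scale c (Φword (l ∷ u) 0 k) +ₚ ∑ (suc k) (λ i → L i ·ₚ Φ₀ p (k ∸ i))
    ≈⟨ +ₚ-congʳ _ (scale-cong c (≋-trans (≡⇒≋ (conv-as-∑ _·ₚ_ (Φletter l) (Φword u) 0 k)) (+ₚ-identityʳ _))) ⟩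
  scale c (∑ (suc k) (λ i → L i ·ₚ Φword u 0 (k ∸ i))) +ₚ ∑ (suc k) (λ i → L i ·ₚ Φ₀ p (k ∸ i))
    ≈⟨ +ₚ-congʳ _ (∑-scale c (suc k) (λ i → L i ·ₚ Φword u 0 (k ∸ i))) ⟩
  ∑ (suc k) (λ i → scale c (L i ·ₚ Φword u 0 (k ∸ i))) +ₚ ∑ (suc k) (λ i → L i ·ₚ Φ₀ p (k ∸ i))
    ≈⟨ ∑-+ₚ (suc k) (λ i → scale c (L i ·ₚ Φword u 0 (k ∸ i))) (λ i → L i ·ₚ Φ₀ p (k ∸ i)) ⟨
  ∑ (suc k) (λ i → scale c (L i ·ₚ Φword u 0 (k ∸ i)) +ₚ (L i ·ₚ Φ₀ p (k ∸ i)))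
    ≈⟨ ∑-cong (suc k) (λ i _ → ≋-trans (+ₚ-congʳ (L i ·ₚ Φ₀ p (k ∸ i)) (≋-sym (·ₚ-scaleʳ c (L i) (Φword u 0 (k ∸ i)))))
                                       (≋-sym (·ₚ-distribˡ (L i) (scale c (Φword u 0 (k ∸ i))) (Φ₀ p (k ∸ i))))) ⟩
  ∑ (suc k) (λ i → L i ·ₚ (scale c (Φword u 0 (k ∸ i)) +ₚ Φ₀ p (k ∸ i)))
    ∎
  where
  open ≋-Reasoning
  L : ℕ → Poly
  L i = Φletter l 0 i

ΦMulˡ-z : ΦMulˡ z Φz
ΦMulˡ-z p k = begin
  Φ₀ (z ·ₚ p) k
    ≡⟨ cong (λ q → Φ₀ q k) (·ₚ-distribʳ (letter x) (letter y) p) ⟩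
  Φ₀ ((letter x ·ₚ p) +ₚ (letter y ·ₚ p)) k
    ≡⟨ Φpoly-+ₚ (letter x ·ₚ p) (letter y ·ₚ p) 0 k ⟩
  Φ₀ (letter x ·ₚ p) k +ₚ Φ₀ (letter y ·ₚ p) k
    ≈⟨ +ₚ-cong (ΦMulˡ-letter x p k) (ΦMulˡ-letter y p k) ⟩
  ∑ (suc k) (λ i → Φletter x 0 i ·ₚ Φ₀ p (k ∸ i)) +ₚ ∑ (suc k) (λ i → Φletter y 0 i ·ₚ Φ₀ p (k ∸ i))
    ≈⟨ ∑-+ₚ (suc k) (λ i → Φletter x 0 i ·ₚ Φ₀ p (k ∸ i)) (λ i → Φletter y 0 i ·ₚ Φ₀ p (k ∸ i)) ⟨
  ∑ (suc k) (λ i → (Φletter x 0 i ·ₚ Φ₀ p (k ∸ i)) +ₚ (Φletter y 0 i ·ₚ Φ₀ p (k ∸ i)))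
    ≈⟨ ∑-cong (suc k) (λ i _ → ≋-trans (≡⇒≋ (sym (·ₚ-distribʳ (Φletter x 0 i) (Φletter y 0 i) (Φ₀ p (k ∸ i)))))
                                       (·ₚ-congʳ (Φ₀ p (k ∸ i)) (Φz-coeff i))) ⟩
  ∑ (suc k) (λ i → Φz i ·ₚ Φ₀ p (k ∸ i))
    ∎
  where open ≋-Reasoning

ΦMulˡ--y : ΦMulˡ -y Φ-y
ΦMulˡ--y p k = begin
  Φ₀ (-y ·ₚ p) k
    ≈⟨ Φpoly-cong 0 k (·ₚ-scaleˡ (ℚ.- 1ℚ) (letter y) p) ⟩
  Φ₀ (-ₚ (letter y ·ₚ p)) k
    ≈⟨ Φpoly-scale (ℚ.- 1ℚ) (letter y ·ₚ p) 0 k ⟩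
  -ₚ Φ₀ (letter y ·ₚ p) k
    ≈⟨ scale-cong (ℚ.- 1ℚ) (ΦMulˡ-letter y p k) ⟩
  -ₚ ∑ (suc k) (λ i → Φletter y 0 i ·ₚ Φ₀ p (k ∸ i))
    ≈⟨ ∑-scale (ℚ.- 1ℚ) (suc k) (λ i → Φletter y 0 i ·ₚ Φ₀ p (k ∸ i)) ⟩
  ∑ (suc k) (λ i → -ₚ (Φletter y 0 i ·ₚ Φ₀ p (k ∸ i)))
    ≈⟨ ∑-cong (suc k) (λ i _ → ≋-trans (≋-sym (·ₚ-scaleˡ (ℚ.- 1ℚ) (Φletter y 0 i) (Φ₀ p (k ∸ i))))
                                       (·ₚ-congʳ (Φ₀ p (k ∸ i)) (Φ-y-coeff i))) ⟩
  ∑ (suc k) (λ i → Φ-y i ·ₚ Φ₀ p (k ∸ i))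
    ∎
  where open ≋-Reasoning

ΦY-cong : ∀ {F G} → (∀ j → F j ≋ G j) → ∀ b → ΦY F b ≋ ΦY G b
ΦY-cong F≋G b = ∑-cong (suc b) (λ j _ → Φpoly-cong 0 (b ∸ j) (F≋G j))

ΦY-+ₚ : ∀ F G b → ΦY (λ j → F j +ₚ G j) b ≋ (ΦY F b +ₚ ΦY G b)
ΦY-+ₚ F G b = ≋-trans (≡⇒≋ (∑-cong-≡ (suc b) (λ j → Φpoly-+ₚ (F j) (G j) 0 (b ∸ j))))
  (∑-+ₚ (suc b) (λ j → Φ₀ (F j) (b ∸ j)) (λ j → Φ₀ (G j) (b ∸ j)))

ΦY-·ₚˡ : ∀ ℓ φ → ΦMulˡ ℓ φ → ∀ F b → ΦY (λ j → ℓ ·ₚ F j) b ≋ ∑ (suc b) (λ i → φ i ·ₚ ΦY F (b ∸ i))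
ΦY-·ₚˡ ℓ φ mul F b = begin
  ∑ (suc b) (λ j → Φ₀ (ℓ ·ₚ F j) (b ∸ j))
    ≈⟨ ∑-cong (suc b) (λ j _ → mul (F j) (b ∸ j)) ⟩
  ∑ (suc b) (λ j → ∑ (suc (b ∸ j)) (λ i → φ i ·ₚ Φ₀ (F j) (b ∸ j ∸ i)))
    ≈⟨ ∑-triangle-swap b (λ i j → φ i ·ₚ Φ₀ (F j) (b ∸ j ∸ i)) ⟩
  ∑ (suc b) (λ i → ∑ (suc (b ∸ i)) (λ j → φ i ·ₚ Φ₀ (F j) (b ∸ j ∸ i)))
    ≡⟨ ∑-cong-≡ (suc b) (λ i → ∑-cong-≡ (suc (b ∸ i)) (λ j → cong (λ m → φ i ·ₚ Φ₀ (F j) m) (∸-comm b j i))) ⟩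
  ∑ (suc b) (λ i → ∑ (suc (b ∸ i)) (λ j → φ i ·ₚ Φ₀ (F j) (b ∸ i ∸ j)))
    ≈⟨ ∑-cong (suc b) (λ i _ → ∑-·ₚˡ (φ i) (suc (b ∸ i)) (λ j → Φ₀ (F j) (b ∸ i ∸ j))) ⟨
  ∑ (suc b) (λ i → φ i ·ₚ ΦY F (b ∸ i))
    ∎
  where
  open ≋-Reasoning
  ∸-comm : ∀ b j i → b ∸ j ∸ i ≡ b ∸ i ∸ j
  ∸-comm b j i = trans (ℕ.∸-+-assoc b j i) (trans (cong (b ∸_) (ℕ.+-comm j i)) (sym (ℕ.∸-+-assoc b i j)))

shuffleCoeff : ℕ → ℕ → Poly
shuffleCoeff a b = z ^ₚ b шₚ -y ^ₚ a

shuffleRecursive-z-y : ShuffleRecursive z -y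
shuffleRecursive-z-y = shuffleRecursive-+ˡ (letter x) (letter y) -y
  (shuffleRecursive-scaleʳ (letter x) (letter y) (ℚ.- 1ℚ) (letter-shuffleRecursive x y))
  (shuffleRecursive-scaleʳ (letter y) (letter y) (ℚ.- 1ℚ) (letter-shuffleRecursive y y))

-- rhsCoeff (suc a) j is the coefficient of X^a Y^j in rhs; the row rhsCoeff 0 = 1 starts the induction.
rhsCoeff : ℕ → ℕ → Poly
rhsCoeff zero j = const 1ₚ 0 j
rhsCoeff (suc a) j = shuffleCoeff a j ·ₚ -y

shiftY : (ℕ → Poly) → ℕ → Poly
shiftY F zero = 0ₚ
shiftY F (suc j) = F j

rhsCoeff-rec : ∀ a j → rhsCoeff (suc a) j ≋ ((-y ·ₚ rhsCoeff a j) +ₚ shiftY (λ i → z ·ₚ rhsCoeff (suc a) i) j)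
rhsCoeff-rec zero zero = begin
  (1ₚ шₚ 1ₚ) ·ₚ -y        ≈⟨ ·ₚ-congʳ -y (шₚ-identityʳ 1ₚ) ⟩
  1ₚ ·ₚ -y                ≈⟨ ·ₚ-identityˡ -y ⟩
  -y                      ≈⟨ ·ₚ-identityʳ -y ⟨
  -y ·ₚ 1ₚ                ≈⟨ +ₚ-identityʳ (-y ·ₚ 1ₚ) ⟨
  (-y ·ₚ 1ₚ) +ₚ 0ₚ        ∎
  where open ≋-Reasoning
rhsCoeff-rec zero (suc j) = begin
  (z ^ₚ suc j шₚ 1ₚ) ·ₚ -y            ≈⟨ ·ₚ-congʳ -y (шₚ-identityʳ (z ^ₚ suc j)) ⟩
  (z ·ₚ z ^ₚ j) ·ₚ -y                 ≡⟨ ·ₚ-assoc z (z ^ₚ j) -y ⟩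
  z ·ₚ (z ^ₚ j ·ₚ -y)                 ≈⟨ ·ₚ-congˡ z (·ₚ-congʳ -y (шₚ-identityʳ (z ^ₚ j))) ⟨
  z ·ₚ rhsCoeff 1 j                   ≈⟨ +ₚ-congʳ (z ·ₚ rhsCoeff 1 j) (·ₚ-zeroʳ -y) ⟨
  (-y ·ₚ 0ₚ) +ₚ (z ·ₚ rhsCoeff 1 j)   ∎
  where open ≋-Reasoning
rhsCoeff-rec (suc a) zero = begin
  (1ₚ шₚ -y ^ₚ suc a) ·ₚ -y           ≈⟨ ·ₚ-congʳ -y (шₚ-identityˡ (-y ^ₚ suc a)) ⟩
  (-y ·ₚ -y ^ₚ a) ·ₚ -y               ≡⟨ ·ₚ-assoc -y (-y ^ₚ a) -y ⟩
  -y ·ₚ (-y ^ₚ a ·ₚ -y)               ≈⟨ ·ₚ-congˡ -y (·ₚ-congʳ -y (шₚ-identityˡ (-y ^ₚ a))) ⟨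
  -y ·ₚ rhsCoeff (suc a) 0            ≈⟨ +ₚ-identityʳ _ ⟨
  (-y ·ₚ rhsCoeff (suc a) 0) +ₚ 0ₚ    ∎
  where open ≋-Reasoning
rhsCoeff-rec (suc a) (suc j) = begin
  shuffleCoeff (suc a) (suc j) ·ₚ -y
    ≈⟨ ·ₚ-congʳ -y (shuffleRecursive-z-y (z ^ₚ j) (-y ^ₚ a)) ⟩
  ((z ·ₚ shuffleCoeff (suc a) j) +ₚ (-y ·ₚ shuffleCoeff a (suc j))) ·ₚ -y
    ≡⟨ trans (·ₚ-distribʳ (z ·ₚ shuffleCoeff (suc a) j) _ -y)
             (cong₂ _+ₚ_ (·ₚ-assoc z (shuffleCoeff (suc a) j) -y) (·ₚ-assoc -y (shuffleCoeff a (suc j)) -y)) ⟩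
  (z ·ₚ rhsCoeff (suc (suc a)) j) +ₚ (-y ·ₚ rhsCoeff (suc a) (suc j))
    ≈⟨ +ₚ-comm (z ·ₚ rhsCoeff (suc (suc a)) j) _ ⟩
  (-y ·ₚ rhsCoeff (suc a) (suc j)) +ₚ (z ·ₚ rhsCoeff (suc (suc a)) j)
    ∎
  where open ≋-Reasoning

^ₚ-suc-·ₚ : ∀ p k q → (p ^ₚ suc k ·ₚ q) ≋ (p ^ₚ k ·ₚ (p ·ₚ q))
^ₚ-suc-·ₚ p zero q = begin
  (p ·ₚ 1ₚ) ·ₚ q        ≈⟨ ·ₚ-congʳ q (·ₚ-identityʳ p) ⟩
  p ·ₚ q                ≈⟨ ·ₚ-identityˡ (p ·ₚ q) ⟨
  1ₚ ·ₚ (p ·ₚ q)        ∎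
  where open ≋-Reasoning
^ₚ-suc-·ₚ p (suc k) q = begin
  (p ·ₚ p ^ₚ suc k) ·ₚ q      ≡⟨ ·ₚ-assoc p (p ^ₚ suc k) q ⟩
  p ·ₚ (p ^ₚ suc k ·ₚ q)      ≈⟨ ·ₚ-congˡ p (^ₚ-suc-·ₚ p k q) ⟩
  p ·ₚ (p ^ₚ k ·ₚ (p ·ₚ q))   ≡⟨ ·ₚ-assoc p (p ^ₚ k) (p ·ₚ q) ⟨
  p ^ₚ suc k ·ₚ (p ·ₚ q)      ∎
  where open ≋-Reasoning

Φ-y-Φz-cancel : ∀ a b → ((Φ-y (suc b) ·ₚ -y ^ₚ a) +ₚ (Φz b ·ₚ -y ^ₚ suc a)) ≋ 0ₚ
Φ-y-Φz-cancel a b = begin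
  ((-ₚ Φz (suc b)) ·ₚ -y ^ₚ a) +ₚ (Φz b ·ₚ -y ^ₚ suc a)
    ≈⟨ +ₚ-congʳ _ (·ₚ-scaleˡ (ℚ.- 1ℚ) (Φz (suc b)) (-y ^ₚ a)) ⟩
  (-ₚ (Φz (suc b) ·ₚ -y ^ₚ a)) +ₚ (Φz b ·ₚ -y ^ₚ suc a)
    ≡⟨ cong₂ (λ p q → (-ₚ p) +ₚ q) (·ₚ-assoc z (-y ^ₚ suc b) (-y ^ₚ a)) (·ₚ-assoc z (-y ^ₚ b) (-y ^ₚ suc a)) ⟩
  (-ₚ (z ·ₚ (-y ^ₚ suc b ·ₚ -y ^ₚ a))) +ₚ (z ·ₚ (-y ^ₚ b ·ₚ -y ^ₚ suc a))
    ≈⟨ +ₚ-congʳ _ (scale-cong (ℚ.- 1ℚ) (·ₚ-congˡ z (^ₚ-suc-·ₚ -y b (-y ^ₚ a)))) ⟩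
  (-ₚ (z ·ₚ (-y ^ₚ b ·ₚ -y ^ₚ suc a))) +ₚ (z ·ₚ (-y ^ₚ b ·ₚ -y ^ₚ suc a))
    ≈⟨ -ₚ-inverseˡ (z ·ₚ (-y ^ₚ b ·ₚ -y ^ₚ suc a)) ⟩
  0ₚ
    ∎
  where open ≋-Reasoning

ΦY-rhsCoeff : ∀ a b → ΦY (rhsCoeff a) b ≋ const (-y ^ₚ a) 0 b
ΦY-rhsCoeff zero b = ≋-trans (∑-head b (λ j → Φ₀ (const 1ₚ 0 j) (b ∸ j)) (λ _ → ≋-refl)) (≋-trans (+ₚ-identityʳ _) (coeffwise λ w →
  trans (coeff-scale 1ℚ (const 1ₚ 0 b) w) (ℚ.*-identityˡ _)))
ΦY-rhsCoeff (suc a) = <-rec _ step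
  where
  open ≋-Reasoning
  Z : ℕ → Poly
  Z i = z ·ₚ rhsCoeff (suc a) i
  shifted : ∀ b → (∀ {m} → m ℕ.< b → ΦY (rhsCoeff (suc a)) m ≋ const (-y ^ₚ suc a) 0 m) →
            ΦY (shiftY Z) b ≋ shiftY (λ b′ → Φz b′ ·ₚ -y ^ₚ suc a) b
  shifted zero _ = ≋-refl
  shifted (suc b) ih = begin
    ΦY Z b                                                        ≈⟨ ΦY-·ₚˡ z Φz ΦMulˡ-z (rhsCoeff (suc a)) b ⟩
    ∑ (suc b) (λ i → Φz i ·ₚ ΦY (rhsCoeff (suc a)) (b ∸ i))       ≈⟨ ∑-cong (suc b) (λ i _ → ·ₚ-congˡ (Φz i) (ih (s≤s (ℕ.m∸n≤m b i)))) ⟩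
    ∑ (suc b) (λ i → Φz i ·ₚ const (-y ^ₚ suc a) 0 (b ∸ i))       ≈⟨ ∑-antidiagonal b (λ i k → Φz i ·ₚ const (-y ^ₚ suc a) 0 k) (λ i _ → ·ₚ-zeroʳ (Φz i)) ⟩
    Φz b ·ₚ -y ^ₚ suc a                                           ∎
  step : ∀ b → (∀ {m} → m ℕ.< b → ΦY (rhsCoeff (suc a)) m ≋ const (-y ^ₚ suc a) 0 m) →
         ΦY (rhsCoeff (suc a)) b ≋ const (-y ^ₚ suc a) 0 b
  step b ih = begin
    ΦY (rhsCoeff (suc a)) b
      ≈⟨ ΦY-cong (rhsCoeff-rec a) b ⟩
    ΦY (λ j → (-y ·ₚ rhsCoeff a j) +ₚ shiftY Z j) b
      ≈⟨ ΦY-+ₚ (λ j → -y ·ₚ rhsCoeff a j) (shiftY Z) b ⟩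
    ΦY (λ j → -y ·ₚ rhsCoeff a j) b +ₚ ΦY (shiftY Z) b
      ≈⟨ +ₚ-cong (ΦY-·ₚˡ -y Φ-y ΦMulˡ--y (rhsCoeff a) b) (shifted b ih) ⟩
    ∑ (suc b) (λ i → Φ-y i ·ₚ ΦY (rhsCoeff a) (b ∸ i)) +ₚ shiftY (λ b′ → Φz b′ ·ₚ -y ^ₚ suc a) b
      ≈⟨ +ₚ-congʳ _ (∑-cong (suc b) (λ i _ → ·ₚ-congˡ (Φ-y i) (ΦY-rhsCoeff a (b ∸ i)))) ⟩
    ∑ (suc b) (λ i → Φ-y i ·ₚ const (-y ^ₚ a) 0 (b ∸ i)) +ₚ shiftY (λ b′ → Φz b′ ·ₚ -y ^ₚ suc a) b
      ≈⟨ +ₚ-congʳ _ (∑-antidiagonal b (λ i k → Φ-y i ·ₚ const (-y ^ₚ a) 0 k) (λ i _ → ·ₚ-zeroʳ (Φ-y i))) ⟩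
    (Φ-y b ·ₚ -y ^ₚ a) +ₚ shiftY (λ b′ → Φz b′ ·ₚ -y ^ₚ suc a) b
      ≈⟨ combine b ⟩
    const (-y ^ₚ suc a) 0 b
      ∎
    where
    combine : ∀ b → ((Φ-y b ·ₚ -y ^ₚ a) +ₚ shiftY (λ b′ → Φz b′ ·ₚ -y ^ₚ suc a) b) ≋ const (-y ^ₚ suc a) 0 b
    combine zero = +ₚ-identityʳ _
    combine (suc b) = Φ-y-Φz-cancel a b

lhsArg-coeff : ∀ a b → lhsArg a b ≋ const (-y ^ₚ suc a) 0 b
lhsArg-coeff a b = begin
  conv _·ₚ_ (const -y) (geom (mono 1 0 -y)) a b    ≈⟨ conv-constˡ _·ₚ_ ·ₚ-zeroˡ -y (geom (mono 1 0 -y)) a b ⟩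
  -y ·ₚ geom (mono 1 0 -y) a b                     ≈⟨ ·ₚ-congˡ -y (geom-monoX -y a b) ⟩
  -y ·ₚ const (-y ^ₚ a) 0 b                        ≈⟨ ·ₚ-mono -y 0 0 (-y ^ₚ a) 0 b ⟩
  const (-y ^ₚ suc a) 0 b                          ∎
  where open ≋-Reasoning

shuffle-geom-coeff : ∀ a b → (geom (mono 0 1 z) шₛ geom (mono 1 0 -y)) a b ≋ shuffleCoeff a b
shuffle-geom-coeff a b = begin
  (geom (mono 0 1 z) шₛ geom (mono 1 0 -y)) a b
    ≡⟨ conv-as-∑ _шₚ_ (geom (mono 0 1 z)) (geom (mono 1 0 -y)) a b ⟩
  ∑ (suc a) (λ i → ∑ (suc b) (λ j → geom (mono 0 1 z) i j шₚ geom (mono 1 0 -y) (a ∸ i) (b ∸ j)))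
    ≈⟨ ∑-cong (suc a) (λ i _ → ∑-cong (suc b) (λ j _ →
         шₚ-cong (geom-monoY z i j) (geom-monoX -y (a ∸ i) (b ∸ j)))) ⟩
  ∑ (suc a) (λ i → ∑ (suc b) (λ j → const (z ^ₚ j) i 0 шₚ const (-y ^ₚ (a ∸ i)) 0 (b ∸ j)))
    ≈⟨ ∑-head a (λ i → ∑ (suc b) (λ j → const (z ^ₚ j) i 0 шₚ const (-y ^ₚ (a ∸ i)) 0 (b ∸ j)))
                 (λ i → ∑-null (suc b) _ (λ _ _ → ≋-refl)) ⟩
  ∑ (suc b) (λ j → z ^ₚ j шₚ const (-y ^ₚ a) 0 (b ∸ j))
    ≈⟨ ∑-antidiagonal b (λ j k → z ^ₚ j шₚ const (-y ^ₚ a) 0 k) (λ j _ → bilinear-zeroʳ _ш_ (z ^ₚ j)) ⟩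
  z ^ₚ b шₚ -y ^ₚ a
    ∎
  where open ≋-Reasoning

rhs-coeff : ∀ a b → rhs a b ≋ rhsCoeff (suc a) b
rhs-coeff a b = ≋-trans (conv-constʳ _·ₚ_ ·ₚ-zeroʳ (geom (mono 0 1 z) шₛ geom (mono 1 0 -y)) -y a b)
                        (·ₚ-congʳ -y (shuffle-geom-coeff a b))

Φ-rhs : Φ rhs ≈ lhsArg
Φ-rhs a b = same-coeff (begin
  Φ rhs a b                  ≈⟨ Φ-coeff rhs a b ⟩
  ΦY (rhs a) b               ≈⟨ ΦY-cong (rhs-coeff a) b ⟩
  ΦY (rhsCoeff (suc a)) b    ≈⟨ ΦY-rhsCoeff (suc a) b ⟩
  const (-y ^ₚ suc a) 0 b    ≈⟨ lhsArg-coeff a b ⟨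
  lhsArg a b                 ∎)
  where open ≋-Reasoning

lemma2 : (Φ rhs ≈ lhsArg) × ((Ψ : Ser → Ser) → IsInverseOfΦ Ψ → Ψ lhsArg ≈ rhs)
lemma2 = Φ-rhs , λ Ψ (Ψ-cong , ΨΦ≈id , _) a b w →
  trans (Ψ-cong lhsArg (Φ rhs) (λ a′ b′ w′ → sym (Φ-rhs a′ b′ w′)) a b w) (ΨΦ≈id rhs a b w)
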